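{- For $n\geq 1$ and $0\leq k\leq n$, let $i_n^k(\emptyset;123)$ be the number of involutions of $\{1,\dots,n\}$ with exactly $k$ fixed points that contain the pattern $123$ exactly once. Then $i_n^3(\emptyset;123)=\frac{3}{n}\binom{n}{(n-3)/2}$ for $n\geq 3$ odd, and $i_n^k(\emptyset;123)=0$ in all other cases.
   Context: Permutations are in one-line notation. An involution is a permutation with $\pi^{ -1}=\pi$; a fixed point is an $i$ with $\pi_i=i$. An occurrence of a pattern $\alpha\in S_m$ in $\pi\in S_n$ is a set of indices $i_1<\dots<i_m$ such that $\pi_{i_1}\cdots\pi_{i_m}$ is order-isomorphic to $\alpha$; $\pi$ contains $\alpha$ exactly once if there is exactly one such occurrence. -}

module Defs where

open import Data.Nat using (ℕ; zero; suc; _<_; _<?_)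
open import Data.Fin using (Fin; toℕ)
open import Data.Fin.Properties using (_≟_)
open import Data.Vec using (Vec; lookup; tabulate)
open import Data.List using (List; []; _∷_; map; concatMap; filter; length)
open import Data.Product using (_×_; _,_)
open import Data.Fin using (_<_) renaming (_<?_ to _<ᶠ?_)
open import Relation.Nullary using (Dec)
open import Relation.Nullary.Decidable using (_×-dec_)
open import Relation.Binary.PropositionalEquality using (_≡_)
open import Data.Nat.Properties using () renaming (_≟_ to _≟ℕ_)
open import Data.List.Relation.Unary.All using (All; all?)
open import Relation.Unary using (Decidable)
open import Data.List using (allFin)

-- Permutation-like maps in one-line notation: π : Fin n → Fin n  (π i = π_{i+1}).
-- All functions Fin m → Fin n, enumerated as a list.
allFuns : (m n : ℕ) → List (Fin m → Fin n)
allFuns zero n = (λ ()) ∷ []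
allFuns (suc m) n =
  concatMap (λ x → map (λ f → λ { Fin.zero → x ; (Fin.suc i) → f i }) (allFuns m n))
            (allFin n)

-- π is an involution: π (π i) = i for all i (this also makes π a bijection).
IsInvolution : {n : ℕ} → (Fin n → Fin n) → Set
IsInvolution {n} π = All (λ i → π (π i) ≡ i) (allFin n)

fixedPoints : {n : ℕ} → (Fin n → Fin n) → ℕ
fixedPoints {n} π = length (filter (λ i → π i ≟ i) (allFin n))

triples : (n : ℕ) → List (Fin n × Fin n × Fin n)
triples n = concatMap (λ a → concatMap (λ b → map (λ c → a , b , c) (allFin n)) (allFin n)) (allFin n)

Occ123 : {n : ℕ} → (Fin n → Fin n) → Fin n × Fin n × Fin n → Set
Occ123 π (a , b , c) = (a Data.Fin.< b) × (b Data.Fin.< c) × (π a Data.Fin.< π b) × (π b Data.Fin.< π c)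

occ123? : {n : ℕ} (π : Fin n → Fin n) → Decidable (Occ123 π)
occ123? π (a , b , c) = (a <ᶠ? b) ×-dec ((b <ᶠ? c) ×-dec ((π a <ᶠ? π b) ×-dec (π b <ᶠ? π c)))

occurrences123 : {n : ℕ} → (Fin n → Fin n) → ℕ
occurrences123 {n} π = length (filter (occ123? π) (triples n))

isInvolution? : {n : ℕ} → Decidable (IsInvolution {n})
isInvolution? {n} π = all? (λ i → π (π i) ≟ i) (allFin n)

Good : {n : ℕ} → ℕ → (Fin n → Fin n) → Set
Good k π = IsInvolution π × (fixedPoints π ≡ k) × (occurrences123 π ≡ 1)

good? : {n : ℕ} (k : ℕ) → Decidable (Good {n} k)
good? k π = isInvolution? π ×-dec ((fixedPoints π ≟ℕ k) ×-dec (occurrences123 π ≟ℕ 1))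

-- i_n^k(∅;123): each function Fin n → Fin n appears exactly once in allFuns n n
i : (n k : ℕ) → ℕ
i n k = length (filter (good? k) (allFuns n n))

{-# OPTIONS --safe #-}
module Submission where

-- In an involution with a unique occurrence (p, q, r) of 123, the inverse occurrence (π p, π q, π r)
-- is again an occurrence, so p, q and r are fixed. Any other fixed point would form a second
-- occurrence with two of them, and away from p and r, π must exchange the positions left of q with
-- those right of q. So π has exactly three fixed points and n = 2q + 1: this gives all the zeros.
--
-- For the count, bound the value at the bottom of every ascent by t (the bound t = n is vacuous).
-- Deleting the two-cycle through the first position, or, when the first position is fixed, the
-- two-cycle of the second and the last position, relates the counts in size n + 2 to those in size n.
-- For n = 2h + 3 the counts F(h, j) at bound j + h + 2 form a ballot triangle:
-- F(h, 0) = h + 1, F(h+1, j+1) = F(h+1, j) + F(h, j+1) for j ≤ h, and F(h+1, h+2) = F(h+1, h+1).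
-- Hence F(h, j) = C(h+1+j, j+1) − C(h+1+j, j−2) (the second term for j ≥ 2 only), and at j = h + 1
-- absorption turns n · (C(2h+2, h+2) − C(2h+2, h−1)) into 3 · C(n, h).

open import Level using (Level)
open import Defs
open import Data.Nat as ℕ using (ℕ; zero; suc; _+_; _*_; _∸_; _/_; _%_; _≤_; z≤n; s≤s)
open import Data.Nat.Properties hiding (_<?_)
open import Data.Nat.ListAction using (sum)
open import Data.Nat.ListAction.Properties using (sum-++)
open import Data.Fin using (Fin; toℕ; _<_; _<?_; inject₁; fromℕ; punchIn; punchOut)
open import Data.Fin.Patterns using (0F; 1F; 2F)
open import Data.Fin.Properties as Fₚ using (all?; punchIn-injective; punchInᵢ≢i; punchIn-punchOut; toℕ-injective; toℕ<n)
  renaming (_≟_ to _≟ᶠ_)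
open import Data.List using (List; []; _∷_; map; concatMap; filter; length; _++_; allFin)
open import Data.List.Properties using (map-++; map-tabulate)
open import Data.List.Membership.Propositional.Properties using (∈-allFin)
import Data.List.Relation.Unary.All as All
open import Data.Nat.DivMod using ([m+kn]%n≡m%n; m*n/n≡m)
open import Data.Nat.Tactic.RingSolver using (solve-∀)
open import Data.Nat.Combinatorics using (_C_; nCk+nC[k+1]≡[n+1]C[k+1]; nCk≡nC[n∸k]; nC1≡n)
open import Data.Nat.Combinatorics.Specification using (k>n⇒nCk≡0)
open import Data.Product using (_×_; _,_; proj₁; proj₂; Σ; ∃)
open import Data.Product.Properties using (≡-dec)
open import Data.Sum using (_⊎_; inj₁; inj₂; [_,_]′)
open import Data.Empty using (⊥-elim)
open import Relation.Nullary using (Dec; yes; no; ¬_; ¬?)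
open import Relation.Nullary.Decidable using (_×-dec_; _→-dec_)
open import Relation.Binary using (tri<; tri≈; tri>)
open import Relation.Binary.PropositionalEquality
open import Function using (_∘_; id; const)
open import Algebra.Properties.CommutativeSemigroup +-commutativeSemigroup using (interchange)

private variable
  ℓ ℓ′ : Level
  A : Set ℓ
  B : Set ℓ′
  P : Set ℓ
  Q : Set ℓ′

-- Indicator sums

𝟙 : Dec P → ℕ
𝟙 (yes _) = 1
𝟙 (no _) = 0

𝟙-yes : (d : Dec P) → P → 𝟙 d ≡ 1
𝟙-yes (yes _) _ = refl
𝟙-yes (no ¬p) p = ⊥-elim (¬p p)

𝟙-no : (d : Dec P) → ¬ P → 𝟙 d ≡ 0
𝟙-no (yes p) ¬p = ⊥-elim (¬p p)
𝟙-no (no _) _ = refl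

𝟙-⇔ : (d : Dec P) (e : Dec Q) → (P → Q) → (Q → P) → 𝟙 d ≡ 𝟙 e
𝟙-⇔ (yes p) e f g = sym (𝟙-yes e (f p))
𝟙-⇔ (no ¬p) e f g = sym (𝟙-no e (¬p ∘ g))

𝟙-× : (d : Dec P) (e : Dec Q) → 𝟙 (d ×-dec e) ≡ 𝟙 d * 𝟙 e
𝟙-× (yes _) (yes _) = refl
𝟙-× (yes _) (no _) = refl
𝟙-× (no _) _ = refl

𝟙-split : (d : Dec P) (e : Dec Q) → 𝟙 d ≡ 𝟙 (d ×-dec ¬? e) + 𝟙 (d ×-dec e)
𝟙-split (yes _) (yes _) = refl
𝟙-split (yes _) (no _) = refl
𝟙-split (no _) _ = refl

𝟙-pos : (d : Dec P) → 0 ℕ.< 𝟙 d → P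
𝟙-pos (yes p) _ = p

∑ : List A → (A → ℕ) → ℕ
∑ xs f = sum (map f xs)

syntax ∑ xs (λ x → e) = ∑[ x ∈ xs ] e

∑-cong : (xs : List A) {f g : A → ℕ} → (∀ x → f x ≡ g x) → ∑ xs f ≡ ∑ xs g
∑-cong [] _ = refl
∑-cong (x ∷ xs) f≡g = cong₂ _+_ (f≡g x) (∑-cong xs f≡g)

∑-++ : (xs ys : List A) (f : A → ℕ) → ∑ (xs ++ ys) f ≡ ∑ xs f + ∑ ys f
∑-++ xs ys f = trans (cong sum (map-++ f xs ys)) (sum-++ (map f xs) (map f ys))

∑-map : (xs : List A) (h : A → B) (f : B → ℕ) → ∑ (map h xs) f ≡ ∑ xs (f ∘ h)
∑-map [] h f = refl
∑-map (x ∷ xs) h f = cong (f (h x) +_) (∑-map xs h f)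

∑-concatMap : (xs : List A) (h : A → List B) (f : B → ℕ) →
  ∑ (concatMap h xs) f ≡ ∑[ x ∈ xs ] ∑ (h x) f
∑-concatMap [] h f = refl
∑-concatMap (x ∷ xs) h f =
  trans (∑-++ (h x) (concatMap h xs) f) (cong (∑ (h x) f +_) (∑-concatMap xs h f))

∑-+ : (xs : List A) (f g : A → ℕ) → ∑[ x ∈ xs ] (f x + g x) ≡ ∑ xs f + ∑ xs g
∑-+ [] f g = refl
∑-+ (x ∷ xs) f g =
  trans (cong (f x + g x +_) (∑-+ xs f g)) (interchange (f x) (g x) (∑ xs f) (∑ xs g))

∑-+₃ : (xs : List A) (f g h : A → ℕ) → ∑[ x ∈ xs ] (f x + g x + h x) ≡ ∑ xs f + ∑ xs g + ∑ xs h
∑-+₃ xs f g h = trans (∑-+ xs (λ x → f x + g x) h) (cong (_+ ∑ xs h) (∑-+ xs f g))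

∑-*ˡ : (xs : List A) (c : ℕ) (f : A → ℕ) → ∑[ x ∈ xs ] (c * f x) ≡ c * ∑ xs f
∑-*ˡ [] c f = sym (*-zeroʳ c)
∑-*ˡ (x ∷ xs) c f = trans (cong (c * f x +_) (∑-*ˡ xs c f)) (sym (*-distribˡ-+ c (f x) _))

∑-*ʳ : (xs : List A) (c : ℕ) (f : A → ℕ) → ∑[ x ∈ xs ] (f x * c) ≡ ∑ xs f * c
∑-*ʳ xs c f = trans (∑-cong xs (λ x → *-comm (f x) c)) (trans (∑-*ˡ xs c f) (*-comm c _))

∑-zero : (xs : List A) {f : A → ℕ} → (∀ x → f x ≡ 0) → ∑ xs f ≡ 0
∑-zero [] _ = refl
∑-zero (x ∷ xs) f≡0 = cong₂ _+_ (f≡0 x) (∑-zero xs f≡0)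

∑-swap : (xs : List A) (ys : List B) (f : A → B → ℕ) →
  ∑[ x ∈ xs ] ∑[ y ∈ ys ] f x y ≡ ∑[ y ∈ ys ] ∑[ x ∈ xs ] f x y
∑-swap [] ys f = sym (∑-zero ys (λ _ → refl))
∑-swap (x ∷ xs) ys f = trans (cong (∑ ys (f x) +_) (∑-swap xs ys f)) (sym (∑-+ ys (f x) _))

∑-mono : (xs : List A) {f g : A → ℕ} → (∀ x → f x ≤ g x) → ∑ xs f ≤ ∑ xs g
∑-mono [] _ = z≤n
∑-mono (x ∷ xs) f≤g = +-mono-≤ (f≤g x) (∑-mono xs f≤g)

∑-pos : (xs : List A) (f : A → ℕ) → 0 ℕ.< ∑ xs f → ∃ λ x → 0 ℕ.< f x
∑-pos (x ∷ xs) f pos with f x in eq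
... | suc _ = x , subst (0 ℕ.<_) (sym eq) (s≤s z≤n)
... | zero = ∑-pos xs f pos

length-filter≡∑𝟙 : {P : A → Set ℓ′} (P? : ∀ x → Dec (P x)) (xs : List A) →
  length (filter P? xs) ≡ ∑[ x ∈ xs ] 𝟙 (P? x)
length-filter≡∑𝟙 P? [] = refl
length-filter≡∑𝟙 P? (x ∷ xs) with P? x
... | yes _ = cong suc (length-filter≡∑𝟙 P? xs)
... | no _ = length-filter≡∑𝟙 P? xs

∑-allFin-suc : ∀ n (f : Fin (suc n) → ℕ) → ∑ (allFin (suc n)) f ≡ f 0F + ∑[ x ∈ allFin n ] f (Fin.suc x)
∑-allFin-suc n f = cong (f 0F +_) (trans (cong (λ xs → ∑ xs f) (sym (map-tabulate id Fin.suc))) (∑-map (allFin n) Fin.suc f))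

∑-allFin-𝟙≟* : ∀ n (a : Fin n) (f : Fin n → ℕ) → ∑[ x ∈ allFin n ] (𝟙 (x ≟ᶠ a) * f x) ≡ f a
∑-allFin-𝟙≟* (suc n) 0F f = begin
  ∑[ x ∈ allFin (suc n) ] (𝟙 (x ≟ᶠ 0F) * f x)
    ≡⟨ ∑-allFin-suc n (λ x → 𝟙 (x ≟ᶠ 0F) * f x) ⟩
  f 0F + 0 + ∑[ x ∈ allFin n ] (𝟙 (Fin.suc x ≟ᶠ 0F) * f (Fin.suc x))
    ≡⟨ cong₂ _+_ (+-identityʳ (f 0F)) (∑-zero (allFin n) (λ x → cong (_* f (Fin.suc x)) (𝟙-no (Fin.suc x ≟ᶠ 0F) λ ()))) ⟩
  f 0F + 0
    ≡⟨ +-identityʳ (f 0F) ⟩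
  f 0F ∎
  where open ≡-Reasoning
∑-allFin-𝟙≟* (suc n) (Fin.suc a) f = begin
  ∑[ x ∈ allFin (suc n) ] (𝟙 (x ≟ᶠ Fin.suc a) * f x)
    ≡⟨ ∑-allFin-suc n (λ x → 𝟙 (x ≟ᶠ Fin.suc a) * f x) ⟩
  ∑[ x ∈ allFin n ] (𝟙 (Fin.suc x ≟ᶠ Fin.suc a) * f (Fin.suc x))
    ≡⟨ ∑-cong (allFin n) (λ x → cong (_* f (Fin.suc x))
         (𝟙-⇔ (Fin.suc x ≟ᶠ Fin.suc a) (x ≟ᶠ a) Fₚ.suc-injective (cong Fin.suc))) ⟩
  ∑[ x ∈ allFin n ] (𝟙 (x ≟ᶠ a) * f (Fin.suc x))
    ≡⟨ ∑-allFin-𝟙≟* n a (f ∘ Fin.suc) ⟩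
  f (Fin.suc a) ∎
  where open ≡-Reasoning

∑-allFin-𝟙≟ : ∀ n (a : Fin n) → ∑[ x ∈ allFin n ] 𝟙 (x ≟ᶠ a) ≡ 1
∑-allFin-𝟙≟ n a = trans (∑-cong (allFin n) (λ x → sym (*-identityʳ _))) (∑-allFin-𝟙≟* n a (λ _ → 1))

∑-allFin-last : ∀ n (f : Fin (suc n) → ℕ) → ∑ (allFin (suc n)) f ≡ ∑[ x ∈ allFin n ] f (inject₁ x) + f (fromℕ n)
∑-allFin-last zero f = +-comm (f 0F) 0
∑-allFin-last (suc n) f = begin
  ∑ (allFin (suc (suc n))) f
    ≡⟨ ∑-allFin-suc (suc n) f ⟩
  f 0F + ∑ (allFin (suc n)) (f ∘ Fin.suc)
    ≡⟨ cong (f 0F +_) (∑-allFin-last n (f ∘ Fin.suc)) ⟩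
  f 0F + (∑[ x ∈ allFin n ] f (Fin.suc (inject₁ x)) + f (fromℕ (suc n)))
    ≡⟨ sym (+-assoc (f 0F) _ _) ⟩
  f 0F + ∑[ x ∈ allFin n ] f (Fin.suc (inject₁ x)) + f (fromℕ (suc n))
    ≡⟨ cong (_+ f (fromℕ (suc n))) (sym (∑-allFin-suc n (f ∘ inject₁))) ⟩
  ∑[ x ∈ allFin (suc n) ] f (inject₁ x) + f (fromℕ (suc n)) ∎
  where open ≡-Reasoning

∑-allFin-1 : ∀ n → ∑[ _ ∈ allFin n ] 1 ≡ n
∑-allFin-1 zero = refl
∑-allFin-1 (suc n) = trans (∑-allFin-suc n (λ _ → 1)) (cong suc (∑-allFin-1 n))

∑-allFin-𝟙< : ∀ n (q : Fin n) → ∑[ i ∈ allFin n ] 𝟙 (i <? q) ≡ toℕ q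
∑-allFin-𝟙< (suc n) 0F = ∑-zero (allFin (suc n)) (λ i → 𝟙-no (i <? Fin.zero {n}) (λ ()))
∑-allFin-𝟙< (suc n) (Fin.suc q) = trans (∑-allFin-suc n (λ i → 𝟙 (i <? Fin.suc q))) (cong suc (trans
  (∑-cong (allFin n) (λ i → 𝟙-⇔ (Fin.suc i <? Fin.suc q) (i <? q) ≤-pred s≤s))
  (∑-allFin-𝟙< n q)))

Endo : ℕ → Set
Endo n = Fin n → Fin n

Involutive : ∀ {n} → Endo n → Set
Involutive π = ∀ i → π (π i) ≡ i

∑-allFin-involution : ∀ n {π : Endo n} → Involutive π → (f : Fin n → ℕ) →
  ∑[ i ∈ allFin n ] f (π i) ≡ ∑ (allFin n) f
∑-allFin-involution n {π} inv f = begin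
  ∑[ i ∈ allFin n ] f (π i)
    ≡⟨ ∑-cong (allFin n) (λ i → sym (∑-allFin-𝟙≟* n (π i) f)) ⟩
  ∑[ i ∈ allFin n ] ∑[ j ∈ allFin n ] (𝟙 (j ≟ᶠ π i) * f j)
    ≡⟨ ∑-swap (allFin n) (allFin n) _ ⟩
  ∑[ j ∈ allFin n ] ∑[ i ∈ allFin n ] (𝟙 (j ≟ᶠ π i) * f j)
    ≡⟨ ∑-cong (allFin n) (λ j → ∑-*ʳ (allFin n) (f j) (λ i → 𝟙 (j ≟ᶠ π i))) ⟩
  ∑[ j ∈ allFin n ] (∑[ i ∈ allFin n ] 𝟙 (j ≟ᶠ π i) * f j)
    ≡⟨ ∑-cong (allFin n) (λ j → cong (_* f j) (trans (∑-cong (allFin n) (λ i → π-swap i j)) (∑-allFin-𝟙≟ n (π j)))) ⟩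
  ∑[ j ∈ allFin n ] (1 * f j)
    ≡⟨ ∑-cong (allFin n) (λ j → *-identityˡ (f j)) ⟩
  ∑ (allFin n) f ∎
  where
  open ≡-Reasoning
  π-swap : ∀ i j → 𝟙 (j ≟ᶠ π i) ≡ 𝟙 (i ≟ᶠ π j)
  π-swap i j = 𝟙-⇔ (j ≟ᶠ π i) (i ≟ᶠ π j)
    (λ e → trans (sym (inv i)) (cong π (sym e))) (λ e → trans (sym (inv j)) (cong π (sym e)))

∑-allFin-trichotomy : ∀ n (q : Fin n) → ∑[ i ∈ allFin n ] (𝟙 (i <? q) + 𝟙 (i ≟ᶠ q) + 𝟙 (q <? i)) ≡ n
∑-allFin-trichotomy n q = trans (∑-cong (allFin n) exactly-one) (∑-allFin-1 n)
  where
  exactly-one : ∀ i → 𝟙 (i <? q) + 𝟙 (i ≟ᶠ q) + 𝟙 (q <? i) ≡ 1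
  exactly-one i with Fₚ.<-cmp i q
  ... | tri< i<q i≢q _ = cong₂ _+_ (cong₂ _+_ (𝟙-yes (i <? q) i<q) (𝟙-no (i ≟ᶠ q) i≢q)) (𝟙-no (q <? i) (<-asym i<q))
  ... | tri≈ _ i≡q _ = cong₂ _+_ (cong₂ _+_ (𝟙-no (i <? q) (<-irrefl (cong toℕ i≡q))) (𝟙-yes (i ≟ᶠ q) i≡q))
                                 (𝟙-no (q <? i) (<-irrefl (cong toℕ (sym i≡q))))
  ... | tri> _ i≢q q<i = cong₂ _+_ (cong₂ _+_ (𝟙-no (i <? q) (<-asym q<i)) (𝟙-no (i ≟ᶠ q) i≢q)) (𝟙-yes (q <? i) q<i)

Triple : ℕ → Set
Triple n = Fin n × Fin n × Fin n

_≟ᵗ_ : ∀ {n} (x y : Triple n) → Dec (x ≡ y)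
_≟ᵗ_ = ≡-dec _≟ᶠ_ (≡-dec _≟ᶠ_ _≟ᶠ_)

∑-triples : ∀ n (f : Triple n → ℕ) →
  ∑ (triples n) f ≡ ∑[ a ∈ allFin n ] ∑[ b ∈ allFin n ] ∑[ c ∈ allFin n ] f (a , b , c)
∑-triples n f = trans (∑-concatMap (allFin n) _ f) (∑-cong (allFin n) (λ a →
  trans (∑-concatMap (allFin n) _ f) (∑-cong (allFin n) (λ b → ∑-map (allFin n) _ f))))

∑-triples-𝟙≟ : ∀ n (o : Triple n) → ∑[ x ∈ triples n ] 𝟙 (x ≟ᵗ o) ≡ 1
∑-triples-𝟙≟ n (a₀ , b₀ , c₀) = begin
  ∑[ x ∈ triples n ] 𝟙 (x ≟ᵗ (a₀ , b₀ , c₀))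
    ≡⟨ ∑-triples n _ ⟩
  ∑[ a ∈ allFin n ] ∑[ b ∈ allFin n ] ∑[ c ∈ allFin n ] 𝟙 ((a , b , c) ≟ᵗ (a₀ , b₀ , c₀))
    ≡⟨ ∑-cong (allFin n) (λ a → ∑-cong (allFin n) (λ b → ∑-cong (allFin n) (factor a b))) ⟩
  ∑[ a ∈ allFin n ] ∑[ b ∈ allFin n ] ∑[ c ∈ allFin n ] (𝟙 (c ≟ᶠ c₀) * (𝟙 (b ≟ᶠ b₀) * (𝟙 (a ≟ᶠ a₀) * 1)))
    ≡⟨ ∑-cong (allFin n) (λ a → ∑-cong (allFin n) (λ b → ∑-allFin-𝟙≟* n c₀ _)) ⟩
  ∑[ a ∈ allFin n ] ∑[ b ∈ allFin n ] (𝟙 (b ≟ᶠ b₀) * (𝟙 (a ≟ᶠ a₀) * 1))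
    ≡⟨ ∑-cong (allFin n) (λ a → ∑-allFin-𝟙≟* n b₀ _) ⟩
  ∑[ a ∈ allFin n ] (𝟙 (a ≟ᶠ a₀) * 1)
    ≡⟨ ∑-allFin-𝟙≟* n a₀ _ ⟩
  1 ∎
  where
  open ≡-Reasoning
  factor : ∀ a b c → 𝟙 ((a , b , c) ≟ᵗ (a₀ , b₀ , c₀)) ≡ 𝟙 (c ≟ᶠ c₀) * (𝟙 (b ≟ᶠ b₀) * (𝟙 (a ≟ᶠ a₀) * 1))
  factor a b c = begin
    𝟙 ((a , b , c) ≟ᵗ (a₀ , b₀ , c₀))
      ≡⟨ 𝟙-⇔ _ ((c ≟ᶠ c₀) ×-dec ((b ≟ᶠ b₀) ×-dec (a ≟ᶠ a₀)))
             (λ { refl → refl , refl , refl }) (λ { (refl , refl , refl) → refl }) ⟩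
    𝟙 ((c ≟ᶠ c₀) ×-dec ((b ≟ᶠ b₀) ×-dec (a ≟ᶠ a₀)))
      ≡⟨ trans (𝟙-× (c ≟ᶠ c₀) _) (cong (𝟙 (c ≟ᶠ c₀) *_) (𝟙-× (b ≟ᶠ b₀) (a ≟ᶠ a₀))) ⟩
    𝟙 (c ≟ᶠ c₀) * (𝟙 (b ≟ᶠ b₀) * 𝟙 (a ≟ᶠ a₀))
      ≡⟨ cong (λ z → 𝟙 (c ≟ᶠ c₀) * (𝟙 (b ≟ᶠ b₀) * z)) (sym (*-identityʳ _)) ⟩
    𝟙 (c ≟ᶠ c₀) * (𝟙 (b ≟ᶠ b₀) * (𝟙 (a ≟ᶠ a₀) * 1)) ∎

Unique123 : ∀ {n} → Endo n → Set
Unique123 {n} π = Σ (Triple n) λ o → Occ123 π o × (∀ o′ → Occ123 π o′ → o′ ≡ o)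

occurrences123≡∑ : ∀ {n} (π : Endo n) → occurrences123 π ≡ ∑[ o ∈ triples n ] 𝟙 (occ123? π o)
occurrences123≡∑ {n} π = length-filter≡∑𝟙 (occ123? π) (triples n)

Unique123⇒occurrences123≡1 : ∀ {n} (π : Endo n) → Unique123 π → occurrences123 π ≡ 1
Unique123⇒occurrences123≡1 {n} π (o , occ , unique) = begin
  occurrences123 π
    ≡⟨ occurrences123≡∑ π ⟩
  ∑[ o′ ∈ triples n ] 𝟙 (occ123? π o′)
    ≡⟨ ∑-cong (triples n) (λ o′ → 𝟙-⇔ (occ123? π o′) (o′ ≟ᵗ o) (unique o′) (λ { refl → occ })) ⟩
  ∑[ o′ ∈ triples n ] 𝟙 (o′ ≟ᵗ o)
    ≡⟨ ∑-triples-𝟙≟ n o ⟩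
  1 ∎
  where open ≡-Reasoning

occurrences123≡1⇒Unique123 : ∀ {n} (π : Endo n) → occurrences123 π ≡ 1 → Unique123 π
occurrences123≡1⇒Unique123 {n} π once
  with ∑-pos (triples n) (λ o → 𝟙 (occ123? π o)) (subst (0 ℕ.<_) (trans (sym once) (occurrences123≡∑ π)) (s≤s z≤n))
... | o , pos = o , occ , unique
  where
  occ : Occ123 π o
  occ = 𝟙-pos (occ123? π o) pos
  unique : ∀ o′ → Occ123 π o′ → o′ ≡ o
  unique o′ occ′ with o′ ≟ᵗ o
  ... | yes o′≡o = o′≡o
  ... | no o′≢o = ⊥-elim (<-irrefl refl (begin
        2                                                     ≡⟨ cong₂ _+_ (∑-triples-𝟙≟ n o) (∑-triples-𝟙≟ n o′) ⟨
        ∑[ x ∈ triples n ] 𝟙 (x ≟ᵗ o) + ∑[ x ∈ triples n ] 𝟙 (x ≟ᵗ o′)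
                                                              ≡⟨ ∑-+ (triples n) _ _ ⟨
        ∑[ x ∈ triples n ] (𝟙 (x ≟ᵗ o) + 𝟙 (x ≟ᵗ o′))       ≤⟨ ∑-mono (triples n) both-occur ⟩
        ∑[ x ∈ triples n ] 𝟙 (occ123? π x)                   ≡⟨ occurrences123≡∑ π ⟨
        occurrences123 π                                      ≡⟨ once ⟩
        1                                                     ∎))
    where
    open ≤-Reasoning
    both-occur : ∀ x → 𝟙 (x ≟ᵗ o) + 𝟙 (x ≟ᵗ o′) ≤ 𝟙 (occ123? π x)
    both-occur x with x ≟ᵗ o | x ≟ᵗ o′
    ... | yes refl | yes refl = ⊥-elim (o′≢o refl)
    ... | yes refl | no _ = ≤-reflexive (sym (𝟙-yes (occ123? π x) occ))
    ... | no _ | yes refl = ≤-reflexive (sym (𝟙-yes (occ123? π x) occ′))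
    ... | no _ | no _ = z≤n

unique123? : ∀ {n} (π : Endo n) → Dec (Unique123 π)
unique123? π with occurrences123 π ℕ.≟ 1
... | yes once = yes (occurrences123≡1⇒Unique123 π once)
... | no ¬once = no (¬once ∘ Unique123⇒occurrences123≡1 π)

-- Counting endofunctions

_≗?_ : ∀ {m n} (f g : Fin m → Fin n) → Dec (f ≗ g)
f ≗? g = all? (λ i → f i ≟ᶠ g i)

∑-allFuns-≗ : ∀ m n (g : Fin m → Fin n) → ∑[ f ∈ allFuns m n ] 𝟙 (f ≗? g) ≡ 1
∑-allFuns-≗ zero n g = refl
∑-allFuns-≗ (suc m) n g = begin
  ∑[ f ∈ allFuns (suc m) n ] 𝟙 (f ≗? g)
    ≡⟨ trans (∑-concatMap (allFin n) _ _) (∑-cong (allFin n) (λ x →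
         trans (∑-map (allFuns m n) _ _) (∑-cong (allFuns m n) (head-tail x)))) ⟩
  ∑[ x ∈ allFin n ] ∑[ f ∈ allFuns m n ] 𝟙 ((x ≟ᶠ g 0F) ×-dec (f ≗? (g ∘ Fin.suc)))
    ≡⟨ ∑-cong (allFin n) (λ x → ∑-cong (allFuns m n) (λ f → 𝟙-× (x ≟ᶠ g 0F) (f ≗? (g ∘ Fin.suc)))) ⟩
  ∑[ x ∈ allFin n ] ∑[ f ∈ allFuns m n ] (𝟙 (x ≟ᶠ g 0F) * 𝟙 (f ≗? (g ∘ Fin.suc)))
    ≡⟨ ∑-cong (allFin n) (λ x → ∑-*ˡ (allFuns m n) (𝟙 (x ≟ᶠ g 0F)) _) ⟩
  ∑[ x ∈ allFin n ] (𝟙 (x ≟ᶠ g 0F) * ∑[ f ∈ allFuns m n ] 𝟙 (f ≗? (g ∘ Fin.suc)))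
    ≡⟨ ∑-allFin-𝟙≟* n (g 0F) _ ⟩
  ∑[ f ∈ allFuns m n ] 𝟙 (f ≗? (g ∘ Fin.suc))
    ≡⟨ ∑-allFuns-≗ m n (g ∘ Fin.suc) ⟩
  1 ∎
  where
  open ≡-Reasoning
  head-tail : ∀ x f → 𝟙 (_ ≗? g) ≡ 𝟙 ((x ≟ᶠ g 0F) ×-dec (f ≗? (g ∘ Fin.suc)))
  head-tail x f = 𝟙-⇔ _ _ (λ e → e 0F , e ∘ Fin.suc) (λ { (e₀ , eₛ) 0F → e₀ ; (e₀ , eₛ) (Fin.suc i) → eₛ i })

#[_] : ∀ {n} {P : Endo n → Set ℓ} → (∀ π → Dec (P π)) → ℕ
#[_] {n = n} P? = ∑[ π ∈ allFuns n n ] 𝟙 (P? π)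

#-⇔ : ∀ {n} {P : Endo n → Set ℓ} {Q : Endo n → Set ℓ′} (P? : ∀ π → Dec (P π)) (Q? : ∀ π → Dec (Q π)) →
  (∀ π → P π → Q π) → (∀ π → Q π → P π) → #[ P? ] ≡ #[ Q? ]
#-⇔ {n = n} P? Q? P⇒Q Q⇒P = ∑-cong (allFuns n n) (λ π → 𝟙-⇔ (P? π) (Q? π) (P⇒Q π) (Q⇒P π))

#-empty : ∀ {n} {P : Endo n → Set ℓ} (P? : ∀ π → Dec (P π)) → (∀ π → ¬ P π) → #[ P? ] ≡ 0
#-empty {n = n} P? ¬P = ∑-zero (allFuns n n) (λ π → 𝟙-no (P? π) (¬P π))

-- Functions are compared pointwise: without function extensionality, glue ∘ rest is the identity only up to ≗.
module Decomposition {n N k : ℕ}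
  {P : Endo N → Set} (P? : ∀ π → Dec (P π))
  {Q : Fin k → Endo n → Set} (Q? : ∀ t ρ → Dec (Q t ρ))
  (glue : Fin k → Endo n → Endo N) (index : Endo N → Fin k) (rest : Endo N → Endo n)
  (P-resp : ∀ {π π′} → π ≗ π′ → P π → P π′)
  (glue-resp : ∀ t {ρ ρ′} → ρ ≗ ρ′ → glue t ρ ≗ glue t ρ′)
  (index-resp : ∀ {π π′} → π ≗ π′ → index π ≡ index π′)
  (rest-resp : ∀ {π π′} → π ≗ π′ → rest π ≗ rest π′)
  (Q⇒P : ∀ t ρ → Q t ρ → P (glue t ρ))
  (P⇒Q : ∀ t ρ → P (glue t ρ) → Q t ρ)
  (glue-index-rest : ∀ π → P π → glue (index π) (rest π) ≗ π)
  (index-glue : ∀ t ρ → Q t ρ → index (glue t ρ) ≡ t)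
  (rest-glue : ∀ t ρ → Q t ρ → rest (glue t ρ) ≗ ρ)
  where

  private
    fibre : Endo N → Fin k → Endo n → ℕ
    fibre π t ρ = 𝟙 (Q? t ρ ×-dec (π ≗? glue t ρ))

    fibre-size : ∀ π → 𝟙 (P? π) ≡ ∑[ t ∈ allFin k ] ∑[ ρ ∈ allFuns n n ] fibre π t ρ
    fibre-size π with P? π
    ... | no ¬p = sym (∑-zero (allFin k) (λ t → ∑-zero (allFuns n n) (λ ρ →
          𝟙-no (Q? t ρ ×-dec (π ≗? glue t ρ)) (λ (q , e) → ¬p (P-resp (λ x → sym (e x)) (Q⇒P t ρ q))))))
    ... | yes p = sym (begin
      ∑[ t ∈ allFin k ] ∑[ ρ ∈ allFuns n n ] fibre π t ρ
        ≡⟨ ∑-cong (allFin k) (λ t → ∑-cong (allFuns n n) (λ ρ →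
             trans (at-decomposition t ρ) (𝟙-× (t ≟ᶠ index π) (ρ ≗? rest π)))) ⟩
      ∑[ t ∈ allFin k ] ∑[ ρ ∈ allFuns n n ] (𝟙 (t ≟ᶠ index π) * 𝟙 (ρ ≗? rest π))
        ≡⟨ ∑-cong (allFin k) (λ t → trans (∑-*ˡ (allFuns n n) (𝟙 (t ≟ᶠ index π)) _)
             (cong (𝟙 (t ≟ᶠ index π) *_) (∑-allFuns-≗ n n (rest π)))) ⟩
      ∑[ t ∈ allFin k ] (𝟙 (t ≟ᶠ index π) * 1)
        ≡⟨ ∑-allFin-𝟙≟* k (index π) (λ _ → 1) ⟩
      1 ∎)
      where
      open ≡-Reasoning
      at-decomposition : ∀ t ρ → fibre π t ρ ≡ 𝟙 ((t ≟ᶠ index π) ×-dec (ρ ≗? rest π))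
      at-decomposition t ρ = 𝟙-⇔ (Q? t ρ ×-dec (π ≗? glue t ρ)) ((t ≟ᶠ index π) ×-dec (ρ ≗? rest π))
        (λ (q , e) → trans (sym (index-glue t ρ q)) (index-resp (λ x → sym (e x))) ,
                     λ x → trans (sym (rest-glue t ρ q x)) (rest-resp (λ y → sym (e y)) x))
        (λ { (refl , e) → let e′ = λ x → sym (trans (glue-resp t e x) (glue-index-rest π p x))
                          in P⇒Q t ρ (P-resp e′ p) , e′ })

  #-decompose : #[ P? ] ≡ ∑[ t ∈ allFin k ] #[ Q? t ]
  #-decompose = begin
    ∑[ π ∈ allFuns N N ] 𝟙 (P? π)
      ≡⟨ ∑-cong (allFuns N N) fibre-size ⟩
    ∑[ π ∈ allFuns N N ] ∑[ t ∈ allFin k ] ∑[ ρ ∈ allFuns n n ] fibre π t ρ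
      ≡⟨ ∑-swap (allFuns N N) (allFin k) (λ π t → ∑[ ρ ∈ allFuns n n ] fibre π t ρ) ⟩
    ∑[ t ∈ allFin k ] ∑[ π ∈ allFuns N N ] ∑[ ρ ∈ allFuns n n ] fibre π t ρ
      ≡⟨ ∑-cong (allFin k) (λ t → ∑-swap (allFuns N N) (allFuns n n) (λ π ρ → fibre π t ρ)) ⟩
    ∑[ t ∈ allFin k ] ∑[ ρ ∈ allFuns n n ] ∑[ π ∈ allFuns N N ] fibre π t ρ
      ≡⟨ ∑-cong (allFin k) (λ t → ∑-cong (allFuns n n) (λ ρ → fibres-over t ρ)) ⟩
    ∑[ t ∈ allFin k ] #[ Q? t ] ∎
    where
    open ≡-Reasoning
    fibres-over : ∀ t ρ → ∑[ π ∈ allFuns N N ] fibre π t ρ ≡ 𝟙 (Q? t ρ)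
    fibres-over t ρ = begin
      ∑[ π ∈ allFuns N N ] fibre π t ρ
        ≡⟨ ∑-cong (allFuns N N) (λ π → 𝟙-× (Q? t ρ) (π ≗? glue t ρ)) ⟩
      ∑[ π ∈ allFuns N N ] (𝟙 (Q? t ρ) * 𝟙 (π ≗? glue t ρ))
        ≡⟨ ∑-*ˡ (allFuns N N) (𝟙 (Q? t ρ)) _ ⟩
      𝟙 (Q? t ρ) * ∑[ π ∈ allFuns N N ] 𝟙 (π ≗? glue t ρ)
        ≡⟨ cong (𝟙 (Q? t ρ) *_) (∑-allFuns-≗ N N (glue t ρ)) ⟩
      𝟙 (Q? t ρ) * 1
        ≡⟨ *-identityʳ _ ⟩
      𝟙 (Q? t ρ) ∎

-- Involutions containing 123 exactly once

module UniqueOccurrence {n} {π : Endo n} (inv : Involutive π) {p q r : Fin n}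
  (occ : Occ123 π (p , q , r)) (unique : ∀ o → Occ123 π o → o ≡ (p , q , r)) where

  p<q : p < q
  p<q = proj₁ occ

  q<r : q < r
  q<r = proj₁ (proj₂ occ)

  private
    inverse-occurrence : (π p , π q , π r) ≡ (p , q , r)
    inverse-occurrence = unique _ (proj₁ (proj₂ (proj₂ occ)) , proj₂ (proj₂ (proj₂ occ)) ,
      subst₂ _<_ (sym (inv p)) (sym (inv q)) p<q , subst₂ _<_ (sym (inv q)) (sym (inv r)) q<r)

  p-fixed : π p ≡ p
  p-fixed = cong proj₁ inverse-occurrence

  q-fixed : π q ≡ q
  q-fixed = cong (proj₁ ∘ proj₂) inverse-occurrence

  r-fixed : π r ≡ r
  r-fixed = cong (proj₂ ∘ proj₂) inverse-occurrence

  private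
    occ-fixed : ∀ {a b c} → π a ≡ a → π b ≡ b → π c ≡ c → a < b → b < c → Occ123 π (a , b , c)
    occ-fixed πa πb πc a<b b<c = a<b , b<c , subst₂ _<_ (sym πa) (sym πb) a<b , subst₂ _<_ (sym πb) (sym πc) b<c

  fixed⇒occurrence : ∀ x → π x ≡ x → x ≡ p ⊎ x ≡ q ⊎ x ≡ r
  fixed⇒occurrence x πx with Fₚ.<-cmp x p
  ... | tri< x<p _ _ = inj₁ (cong proj₁ (unique _ (occ-fixed πx p-fixed q-fixed x<p p<q)))
  ... | tri≈ _ x≡p _ = inj₁ x≡p
  ... | tri> _ _ p<x with Fₚ.<-cmp x q
  ...   | tri< x<q _ _ = inj₂ (inj₁ (cong (proj₁ ∘ proj₂) (unique _ (occ-fixed p-fixed πx q-fixed p<x x<q))))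
  ...   | tri≈ _ x≡q _ = inj₂ (inj₁ x≡q)
  ...   | tri> _ _ q<x with Fₚ.<-cmp x r
  ...     | tri< x<r _ _ = inj₂ (inj₁ (cong (proj₁ ∘ proj₂) (unique _ (occ-fixed q-fixed πx r-fixed q<x x<r))))
  ...     | tri≈ _ x≡r _ = inj₂ (inj₂ x≡r)
  ...     | tri> _ _ r<x = inj₂ (inj₂ (cong (proj₂ ∘ proj₂) (unique _ (occ-fixed q-fixed r-fixed πx q<r r<x))))

  below-q : ∀ x → x < q → π x < q → x ≡ p
  below-q x x<q πx<q = cong proj₁ (unique _ (x<q , q<r , subst (π x <_) (sym q-fixed) πx<q , proj₂ (proj₂ (proj₂ occ))))

  above-q : ∀ x → q < x → q < π x → x ≡ r
  above-q x q<x q<πx = cong (proj₂ ∘ proj₂) (unique _ (p<q , q<x , proj₁ (proj₂ (proj₂ occ)) , subst (_< π x) (sym q-fixed) q<πx))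

  fixedPoints≡3 : fixedPoints π ≡ 3
  fixedPoints≡3 = begin
    fixedPoints π
      ≡⟨ length-filter≡∑𝟙 (λ i → π i ≟ᶠ i) (allFin n) ⟩
    ∑[ i ∈ allFin n ] 𝟙 (π i ≟ᶠ i)
      ≡⟨ ∑-cong (allFin n) fixed-indicator ⟩
    ∑[ i ∈ allFin n ] (𝟙 (i ≟ᶠ p) + 𝟙 (i ≟ᶠ q) + 𝟙 (i ≟ᶠ r))
      ≡⟨ ∑-+₃ (allFin n) _ _ _ ⟩
    ∑[ i ∈ allFin n ] 𝟙 (i ≟ᶠ p) + ∑[ i ∈ allFin n ] 𝟙 (i ≟ᶠ q) + ∑[ i ∈ allFin n ] 𝟙 (i ≟ᶠ r)
      ≡⟨ cong₂ _+_ (cong₂ _+_ (∑-allFin-𝟙≟ n p) (∑-allFin-𝟙≟ n q)) (∑-allFin-𝟙≟ n r) ⟩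
    3 ∎
    where
    open ≡-Reasoning
    fixed-indicator : ∀ i → 𝟙 (π i ≟ᶠ i) ≡ 𝟙 (i ≟ᶠ p) + 𝟙 (i ≟ᶠ q) + 𝟙 (i ≟ᶠ r)
    fixed-indicator i with i ≟ᶠ p | i ≟ᶠ q | i ≟ᶠ r
    ... | yes refl | yes p≡q | _ = ⊥-elim (Fₚ.<⇒≢ p<q p≡q)
    ... | yes refl | no _ | yes p≡r = ⊥-elim (Fₚ.<⇒≢ (<-trans p<q q<r) p≡r)
    ... | yes refl | no _ | no _ = 𝟙-yes (π i ≟ᶠ i) p-fixed
    ... | no _ | yes refl | yes q≡r = ⊥-elim (Fₚ.<⇒≢ q<r q≡r)
    ... | no _ | yes refl | no _ = 𝟙-yes (π i ≟ᶠ i) q-fixed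
    ... | no _ | no _ | yes refl = 𝟙-yes (π i ≟ᶠ i) r-fixed
    ... | no i≢p | no i≢q | no i≢r = 𝟙-no (π i ≟ᶠ i) ([ i≢p , [ i≢q , i≢r ]′ ]′ ∘ fixed⇒occurrence i)

  -- Apart from p and r, π exchanges the positions left of q with those right of q.
  swaps-sides : ∀ i → 𝟙 (π i <? q) + 𝟙 (i ≟ᶠ r) ≡ 𝟙 (q <? i) + 𝟙 (i ≟ᶠ p)
  swaps-sides i with i ≟ᶠ p | i ≟ᶠ r | i ≟ᶠ q
  ... | yes refl | yes p≡r | _ = ⊥-elim (Fₚ.<⇒≢ (<-trans p<q q<r) p≡r)
  ... | yes refl | no _ | _ = trans (cong (_+ 0) (𝟙-yes (π i <? q) (subst (_< q) (sym p-fixed) p<q)))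
                                    (sym (cong (_+ 1) (𝟙-no (q <? i) (<-asym p<q))))
  ... | no _ | yes refl | _ = trans (cong (_+ 1) (𝟙-no (π i <? q) (λ πr<q → <-asym q<r (subst (_< q) r-fixed πr<q))))
                                    (sym (cong (_+ 0) (𝟙-yes (q <? i) q<r)))
  ... | no _ | no _ | yes refl = trans (cong (_+ 0) (𝟙-no (π i <? q) (λ πq<q → <-irrefl refl (subst (_< q) q-fixed πq<q))))
                                       (sym (cong (_+ 0) (𝟙-no (q <? i) (<-irrefl refl))))
  ... | no i≢p | no i≢r | no i≢q = cong (_+ 0) (𝟙-⇔ (π i <? q) (q <? i) left⇒right right⇒left)
    where
    left⇒right : π i < q → q < i
    left⇒right πi<q with Fₚ.<-cmp i q
    ... | tri< i<q _ _ = ⊥-elim (i≢p (below-q i i<q πi<q))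
    ... | tri≈ _ i≡q _ = ⊥-elim (i≢q i≡q)
    ... | tri> _ _ q<i = q<i
    right⇒left : q < i → π i < q
    right⇒left q<i with Fₚ.<-cmp (π i) q
    ... | tri< πi<q _ _ = πi<q
    ... | tri≈ _ πi≡q _ = ⊥-elim (i≢q (trans (sym (inv i)) (trans (cong π πi≡q) q-fixed)))
    ... | tri> _ _ q<πi = ⊥-elim (i≢r (above-q i q<i q<πi))

  #right-of-q : ∑[ i ∈ allFin n ] 𝟙 (q <? i) ≡ toℕ q
  #right-of-q = begin
    ∑[ i ∈ allFin n ] 𝟙 (q <? i)
      ≡⟨ +-cancelʳ-≡ 1 _ _ (begin
           ∑[ i ∈ allFin n ] 𝟙 (q <? i) + 1
             ≡⟨ cong₂ _+_ refl (∑-allFin-𝟙≟ n p) ⟨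
           ∑[ i ∈ allFin n ] 𝟙 (q <? i) + ∑[ i ∈ allFin n ] 𝟙 (i ≟ᶠ p)
             ≡⟨ ∑-+ (allFin n) _ _ ⟨
           ∑[ i ∈ allFin n ] (𝟙 (q <? i) + 𝟙 (i ≟ᶠ p))
             ≡⟨ ∑-cong (allFin n) swaps-sides ⟨
           ∑[ i ∈ allFin n ] (𝟙 (π i <? q) + 𝟙 (i ≟ᶠ r))
             ≡⟨ ∑-+ (allFin n) _ _ ⟩
           ∑[ i ∈ allFin n ] 𝟙 (π i <? q) + ∑[ i ∈ allFin n ] 𝟙 (i ≟ᶠ r)
             ≡⟨ cong₂ _+_ refl (∑-allFin-𝟙≟ n r) ⟩
           ∑[ i ∈ allFin n ] 𝟙 (π i <? q) + 1 ∎) ⟩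
    ∑[ i ∈ allFin n ] 𝟙 (π i <? q)
      ≡⟨ ∑-allFin-involution n inv (λ j → 𝟙 (j <? q)) ⟩
    ∑[ j ∈ allFin n ] 𝟙 (j <? q)
      ≡⟨ ∑-allFin-𝟙< n q ⟩
    toℕ q ∎
    where open ≡-Reasoning

  n≡2q+1 : n ≡ toℕ q + suc (toℕ q)
  n≡2q+1 = begin
    n
      ≡⟨ ∑-allFin-trichotomy n q ⟨
    ∑[ i ∈ allFin n ] (𝟙 (i <? q) + 𝟙 (i ≟ᶠ q) + 𝟙 (q <? i))
      ≡⟨ ∑-+₃ (allFin n) _ _ _ ⟩
    ∑[ i ∈ allFin n ] 𝟙 (i <? q) + ∑[ i ∈ allFin n ] 𝟙 (i ≟ᶠ q) + ∑[ i ∈ allFin n ] 𝟙 (q <? i)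
      ≡⟨ cong₂ _+_ (cong₂ _+_ (∑-allFin-𝟙< n q) (∑-allFin-𝟙≟ n q)) #right-of-q ⟩
    toℕ q + 1 + toℕ q
      ≡⟨ +-assoc (toℕ q) 1 (toℕ q) ⟩
    toℕ q + suc (toℕ q) ∎
    where open ≡-Reasoning

involutive? : ∀ {n} (π : Endo n) → Dec (Involutive π)
involutive? π = all? (λ i → π (π i) ≟ᶠ i)

IsInvolution⇒Involutive : ∀ {n} {π : Endo n} → IsInvolution π → Involutive π
IsInvolution⇒Involutive inv i = All.lookup inv (∈-allFin i)

Involutive⇒IsInvolution : ∀ {n} {π : Endo n} → Involutive π → IsInvolution π
Involutive⇒IsInvolution inv = All.tabulate (λ {i} _ → inv i)

Good⇒odd∧three : ∀ {n k} {π : Endo n} → Good k π → 3 ≤ n × n % 2 ≡ 1 × k ≡ 3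
Good⇒odd∧three {n} {π = π} (isInv , fixed≡k , once) with occurrences123≡1⇒Unique123 π once
... | (p , q , r) , occ , unique = three≤n , n-odd , trans (sym fixed≡k) fixedPoints≡3
  where
  open UniqueOccurrence (IsInvolution⇒Involutive {π = π} isInv) occ unique
  three≤n : 3 ≤ n
  three≤n = ≤-trans (s≤s (≤-trans (s≤s (≤-trans (s≤s z≤n) p<q)) q<r)) (toℕ<n r)
  n-odd : n % 2 ≡ 1
  n-odd = begin
    n % 2                         ≡⟨ cong (_% 2) n≡2q+1 ⟩
    (toℕ q + suc (toℕ q)) % 2     ≡⟨ cong (_% 2) (x+[1+x]≡1+x*2 (toℕ q)) ⟩
    (1 + toℕ q * 2) % 2           ≡⟨ [m+kn]%n≡m%n 1 (toℕ q) 2 ⟩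
    1 ∎
    where
    open ≡-Reasoning
    x+[1+x]≡1+x*2 : ∀ x → x + suc x ≡ 1 + x * 2
    x+[1+x]≡1+x*2 = solve-∀

i≡0 : ∀ n k → ¬ (3 ≤ n × n % 2 ≡ 1 × k ≡ 3) → i n k ≡ 0
i≡0 n k ¬odd∧three = trans (length-filter≡∑𝟙 (good? k) (allFuns n n))
  (#-empty (good? k) (λ π → ¬odd∧three ∘ Good⇒odd∧three))

involutive-injective : ∀ {n} {π : Endo n} → Involutive π → ∀ {x y} → π x ≡ π y → x ≡ y
involutive-injective {π = π} inv {x} {y} πx≡πy = trans (sym (inv x)) (trans (cong π πx≡πy) (inv y))

1<⇐≢0,1 : ∀ {n} {z : Fin (suc (suc n))} → z ≢ 0F → z ≢ 1F → Fin.suc (Fin.zero {suc n}) < z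
1<⇐≢0,1 {z = 0F} z≢0 _ = ⊥-elim (z≢0 refl)
1<⇐≢0,1 {z = 1F} _ z≢1 = ⊥-elim (z≢1 refl)
1<⇐≢0,1 {z = Fin.suc (Fin.suc _)} _ _ = s≤s (s≤s z≤n)

<fromℕ⇐≢ : ∀ {n} {z : Fin (suc n)} → z ≢ fromℕ n → z < fromℕ n
<fromℕ⇐≢ {z = z} z≢last = ≤∧≢⇒< (Fₚ.≤fromℕ z) (z≢last ∘ toℕ-injective)

-- If the first position is fixed, (0, 1, π⁻¹ last) would be the occurrence, and then (1, 2, last) a second one.
fixes-0⇒1↦last : ∀ {k} {π : Endo (suc (suc (suc (suc k))))} → Involutive π → Unique123 π →
  π 0F ≡ 0F → π 1F ≡ fromℕ (suc (suc (suc k)))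
fixes-0⇒1↦last {k} {π} inv ((p , q , r) , occ , unique) π0≡0 with π 1F ≟ᶠ fromℕ (suc (suc (suc k)))
... | yes π1≡last = π1≡last
... | no π1≢last = ⊥-elim (0≢1 (cong proj₁ (trans (unique _ occ₀₁ⱼ) (sym (unique _ occ₁₂ₗ)))))
  where
  open UniqueOccurrence inv occ unique
  last = fromℕ (suc (suc (suc k)))
  j = π last
  0≢1 : 0F ≢ 1F
  0≢1 ()
  0≢last : 0F ≢ last
  0≢last ()
  π-avoids : ∀ {x y} → π y ≡ y → x ≢ y → π x ≢ y
  π-avoids πy≡y x≢y πx≡y = x≢y (involutive-injective inv (trans πx≡y (sym πy≡y)))
  occ₀₁ⱼ : Occ123 π (0F , 1F , j)
  occ₀₁ⱼ = s≤s z≤n ,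
           1<⇐≢0,1 (λ j≡0 → 0≢last (trans (sym π0≡0) (trans (cong π (sym j≡0)) (inv last))))
                    (λ j≡1 → π1≢last (trans (cong π (sym j≡1)) (inv last))) ,
           subst (_< π 1F) (sym π0≡0) (≤∧≢⇒< z≤n (π-avoids π0≡0 (λ ()) ∘ sym ∘ toℕ-injective)) ,
           subst (π 1F <_) (sym (inv last)) (<fromℕ⇐≢ π1≢last)
  q≡1 : q ≡ 1F
  q≡1 = sym (cong (proj₁ ∘ proj₂) (unique _ occ₀₁ⱼ))
  π1≡1 : π 1F ≡ 1F
  π1≡1 = subst (λ z → π z ≡ z) q≡1 q-fixed
  j≡last : j ≡ last
  j≡last = trans (sym (subst (λ z → π z ≡ z) (sym (cong (proj₂ ∘ proj₂) (unique _ occ₀₁ⱼ))) r-fixed)) (inv last)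
  occ₁₂ₗ : Occ123 π (1F , 2F , last)
  occ₁₂ₗ = s≤s (s≤s z≤n) , <fromℕ⇐≢ (λ ()) ,
           subst (_< π 2F) (sym π1≡1) (1<⇐≢0,1 (π-avoids π0≡0 (λ ())) (π-avoids π1≡1 (λ ()))) ,
           subst (π 2F <_) (sym (trans (cong π (sym j≡last)) (inv last)))
             (<fromℕ⇐≢ (π-avoids (trans (cong π (sym j≡last)) (inv last)) (λ ())))

-- Inserting a two-cycle

toℕ-punchIn-< : ∀ {n} (i : Fin (suc n)) (j : Fin n) → toℕ j ℕ.< toℕ i → toℕ (punchIn i j) ≡ toℕ j
toℕ-punchIn-< (Fin.suc i) 0F _ = refl
toℕ-punchIn-< (Fin.suc i) (Fin.suc j) (s≤s j<i) = cong suc (toℕ-punchIn-< i j j<i)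

toℕ-punchIn-≥ : ∀ {n} (i : Fin (suc n)) (j : Fin n) → toℕ i ≤ toℕ j → toℕ (punchIn i j) ≡ suc (toℕ j)
toℕ-punchIn-≥ 0F j _ = refl
toℕ-punchIn-≥ (Fin.suc i) (Fin.suc j) (s≤s i≤j) = cong suc (toℕ-punchIn-≥ i j i≤j)

toℕ-punchIn-≤ : ∀ {n} (i : Fin (suc n)) (j : Fin n) → toℕ (punchIn i j) ≤ suc (toℕ j)
toℕ-punchIn-≤ 0F j = ≤-refl
toℕ-punchIn-≤ (Fin.suc i) 0F = z≤n
toℕ-punchIn-≤ (Fin.suc i) (Fin.suc j) = s≤s (toℕ-punchIn-≤ i j)

punchIn-mono-< : ∀ {n} (k : Fin (suc n)) {x y : Fin n} → x < y → punchIn k x < punchIn k y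
punchIn-mono-< k x<y = ≰⇒> (λ y≤x → <⇒≱ x<y (Fₚ.punchIn-cancel-≤ k _ _ y≤x))

punchIn-cancel-< : ∀ {n} (k : Fin (suc n)) {x y : Fin n} → punchIn k x < punchIn k y → x < y
punchIn-cancel-< k h = ≰⇒> (λ y≤x → <⇒≱ h (Fₚ.punchIn-mono-≤ k _ _ y≤x))

-- ρ : Endo n is extended by the two-cycle (a b), renumbering the other positions through embed;
-- giving b as punchIn a s makes b ≢ a by construction.
module TwoCycle {n : ℕ} (a : Fin (suc (suc n))) (s : Fin (suc n)) where

  b : Fin (suc (suc n))
  b = punchIn a s

  embed : Fin n → Fin (suc (suc n))
  embed x = punchIn a (punchIn s x)

  b≢a : b ≢ a
  b≢a = punchInᵢ≢i a s

  embed≢a : ∀ x → embed x ≢ a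
  embed≢a x = punchInᵢ≢i a _

  embed≢b : ∀ x → embed x ≢ b
  embed≢b x = punchInᵢ≢i s x ∘ punchIn-injective a _ _

  embed-injective : ∀ {x y} → embed x ≡ embed y → x ≡ y
  embed-injective = punchIn-injective s _ _ ∘ punchIn-injective a _ _

  embed-mono-< : ∀ {x y} → x < y → embed x < embed y
  embed-mono-< = punchIn-mono-< a ∘ punchIn-mono-< s

  embed-cancel-< : ∀ {x y} → embed x < embed y → x < y
  embed-cancel-< = punchIn-cancel-< s ∘ punchIn-cancel-< a

  embed³ : Triple n → Triple (suc (suc n))
  embed³ (i , j , k) = embed i , embed j , embed k

  embed³-injective : ∀ {o o′} → embed³ o ≡ embed³ o′ → o ≡ o′
  embed³-injective {_ , _ , _} {_ , _ , _} eq = cong₂ _,_ (embed-injective (cong proj₁ eq))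
    (cong₂ _,_ (embed-injective (cong (proj₁ ∘ proj₂) eq)) (embed-injective (cong (proj₂ ∘ proj₂) eq)))

  unembed : ∀ z → z ≢ a → z ≢ b → Fin n
  unembed z z≢a z≢b = punchOut {i = s} {j = punchOut {i = a} {j = z} (z≢a ∘ sym)}
    (λ eq → z≢b (sym (trans (cong (punchIn a) eq) (punchIn-punchOut (z≢a ∘ sym)))))

  embed-unembed : ∀ z z≢a z≢b → embed (unembed z z≢a z≢b) ≡ z
  embed-unembed z _ _ = trans (cong (punchIn a) (punchIn-punchOut _)) (punchIn-punchOut _)

  unembed-embed : ∀ x z≢a z≢b → unembed (embed x) z≢a z≢b ≡ x
  unembed-embed x z≢a z≢b = embed-injective (embed-unembed (embed x) z≢a z≢b)

  data Position : Fin (suc (suc n)) → Set where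
    at-a : Position a
    at-b : Position b
    inner : ∀ x → Position (embed x)

  position : ∀ z → Position z
  position z with z ≟ᶠ a
  ... | yes refl = at-a
  ... | no z≢a with z ≟ᶠ b
  ... | yes refl = at-b
  ... | no z≢b = subst Position (embed-unembed z z≢a z≢b) (inner (unembed z z≢a z≢b))

  extend : Endo n → Endo (suc (suc n))
  extend ρ z with z ≟ᶠ a
  ... | yes _ = b
  ... | no z≢a with z ≟ᶠ b
  ... | yes _ = a
  ... | no z≢b = embed (ρ (unembed z z≢a z≢b))

  extend-a : ∀ ρ → extend ρ a ≡ b
  extend-a ρ with a ≟ᶠ a
  ... | yes _ = refl
  ... | no a≢a = ⊥-elim (a≢a refl)

  extend-b : ∀ ρ → extend ρ b ≡ a
  extend-b ρ with b ≟ᶠ a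
  ... | yes b≡a = ⊥-elim (b≢a b≡a)
  ... | no _ with b ≟ᶠ b
  ... | yes _ = refl
  ... | no b≢b = ⊥-elim (b≢b refl)

  extend-embed : ∀ ρ x → extend ρ (embed x) ≡ embed (ρ x)
  extend-embed ρ x with embed x ≟ᶠ a
  ... | yes e≡a = ⊥-elim (embed≢a x e≡a)
  ... | no e≢a with embed x ≟ᶠ b
  ... | yes e≡b = ⊥-elim (embed≢b x e≡b)
  ... | no e≢b = cong (embed ∘ ρ) (unembed-embed x e≢a e≢b)

  extend-cong : ∀ {ρ ρ′} → ρ ≗ ρ′ → extend ρ ≗ extend ρ′
  extend-cong {ρ} {ρ′} ρ≗ρ′ z with position z
  ... | at-a = trans (extend-a ρ) (sym (extend-a ρ′))
  ... | at-b = trans (extend-b ρ) (sym (extend-b ρ′))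
  ... | inner x = trans (extend-embed ρ x) (trans (cong embed (ρ≗ρ′ x)) (sym (extend-embed ρ′ x)))

  extend-involutive : ∀ {ρ} → Involutive ρ → Involutive (extend ρ)
  extend-involutive {ρ} inv z with position z
  ... | at-a = trans (cong (extend ρ) (extend-a ρ)) (extend-b ρ)
  ... | at-b = trans (cong (extend ρ) (extend-b ρ)) (extend-a ρ)
  ... | inner x = trans (cong (extend ρ) (extend-embed ρ x)) (trans (extend-embed ρ (ρ x)) (cong embed (inv x)))

  extend-involutive⁻¹ : ∀ {ρ} → Involutive (extend ρ) → Involutive ρ
  extend-involutive⁻¹ {ρ} inv x = embed-injective (begin
    embed (ρ (ρ x))             ≡⟨ extend-embed ρ (ρ x) ⟨
    extend ρ (embed (ρ x))      ≡⟨ cong (extend ρ) (extend-embed ρ x) ⟨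
    extend ρ (extend ρ (embed x)) ≡⟨ inv (embed x) ⟩
    embed x ∎)
    where open ≡-Reasoning

  extend-fixed⇒inner : ∀ ρ z → extend ρ z ≡ z → ∃ λ x → z ≡ embed x
  extend-fixed⇒inner ρ z fixed with position z
  ... | at-a = ⊥-elim (b≢a (trans (sym (extend-a ρ)) fixed))
  ... | at-b = ⊥-elim (b≢a (sym (trans (sym (extend-b ρ)) fixed)))
  ... | inner x = x , refl

  extend-embed-mono-< : ∀ ρ {i j} → ρ i < ρ j → extend ρ (embed i) < extend ρ (embed j)
  extend-embed-mono-< ρ {i} {j} ρi<ρj = subst₂ _<_ (sym (extend-embed ρ i)) (sym (extend-embed ρ j)) (embed-mono-< ρi<ρj)

  extend-embed-cancel-< : ∀ ρ {i j} → extend ρ (embed i) < extend ρ (embed j) → ρ i < ρ j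
  extend-embed-cancel-< ρ {i} {j} h = embed-cancel-< (subst₂ _<_ (extend-embed ρ i) (extend-embed ρ j) h)

  extend-occ : ∀ ρ {o} → Occ123 ρ o → Occ123 (extend ρ) (embed³ o)
  extend-occ ρ (i<j , j<k , ρi<ρj , ρj<ρk) =
    embed-mono-< i<j , embed-mono-< j<k , extend-embed-mono-< ρ ρi<ρj , extend-embed-mono-< ρ ρj<ρk

  extend-occ⁻¹ : ∀ ρ {o} → Occ123 (extend ρ) (embed³ o) → Occ123 ρ o
  extend-occ⁻¹ ρ (i<j , j<k , ρi<ρj , ρj<ρk) =
    embed-cancel-< i<j , embed-cancel-< j<k , extend-embed-cancel-< ρ ρi<ρj , extend-embed-cancel-< ρ ρj<ρk

  -- Off the image of embed the default value d is returned, so that restrict is total.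
  unembedOr : Fin (suc (suc n)) → Fin n → Fin n
  unembedOr z d with z ≟ᶠ a
  ... | yes _ = d
  ... | no z≢a with z ≟ᶠ b
  ... | yes _ = d
  ... | no z≢b = unembed z z≢a z≢b

  unembedOr-embed : ∀ x d → unembedOr (embed x) d ≡ x
  unembedOr-embed x d with embed x ≟ᶠ a
  ... | yes e≡a = ⊥-elim (embed≢a x e≡a)
  ... | no e≢a with embed x ≟ᶠ b
  ... | yes e≡b = ⊥-elim (embed≢b x e≡b)
  ... | no e≢b = unembed-embed x e≢a e≢b

  embed-unembedOr : ∀ z d → z ≢ a → z ≢ b → embed (unembedOr z d) ≡ z
  embed-unembedOr z d z≢a z≢b with position z
  ... | at-a = ⊥-elim (z≢a refl)
  ... | at-b = ⊥-elim (z≢b refl)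
  ... | inner x = cong embed (unembedOr-embed x d)

  restrict : Endo (suc (suc n)) → Endo n
  restrict π x = unembedOr (π (embed x)) x

  restrict-cong : ∀ {π π′} → π ≗ π′ → restrict π ≗ restrict π′
  restrict-cong π≗π′ x = cong (λ z → unembedOr z x) (π≗π′ (embed x))

  restrict-extend : ∀ ρ → restrict (extend ρ) ≗ ρ
  restrict-extend ρ x = trans (cong (λ z → unembedOr z x) (extend-embed ρ x)) (unembedOr-embed (ρ x) x)

  extend-restrict : ∀ {π} → Involutive π → π a ≡ b → extend (restrict π) ≗ π
  extend-restrict {π} inv πa≡b z with position z
  ... | at-a = trans (extend-a _) (sym πa≡b)
  ... | at-b = trans (extend-b _) (sym (trans (cong π (sym πa≡b)) (inv a)))
  ... | inner x = trans (extend-embed _ x) (embed-unembedOr (π (embed x)) x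
      (λ πe≡a → embed≢b x (trans (sym (inv (embed x))) (trans (cong π πe≡a) πa≡b)))
      (λ πe≡b → embed≢a x (trans (sym (inv (embed x))) (trans (cong π πe≡b) (trans (cong π (sym πa≡b)) (inv a))))))

-- Bounded ascents

AscentsBelow : ∀ {n} → Endo n → ℕ → Set
AscentsBelow π t = ∀ i j → i < j → π i < π j → toℕ (π i) ℕ.< t

ascentsBelow? : ∀ {n} (π : Endo n) t → Dec (AscentsBelow π t)
ascentsBelow? π t = all? (λ i → all? (λ j → (i <? j) →-dec ((π i <? π j) →-dec (toℕ (π i) ℕ.<? t))))

ascentsBelow-≥ : ∀ {n} (π : Endo n) {t} → n ≤ t → AscentsBelow π t
ascentsBelow-≥ π n≤t i _ _ _ = ≤-trans (toℕ<n (π i)) n≤t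

occ123⇒ascentsBelow⇒2≤ : ∀ {n} {π : Endo n} {o} → Occ123 π o → ∀ {t} → AscentsBelow π t → 2 ≤ t
occ123⇒ascentsBelow⇒2≤ {o = _ , j , k} (_ , j<k , πi<πj , πj<πk) asc =
  ≤-trans (s≤s (≤-trans (s≤s z≤n) πi<πj)) (asc j k j<k πj<πk)

toℕ-pos : ∀ {n} {x y : Fin n} → x < y → 0 ℕ.< toℕ y
toℕ-pos x<y = ≤-trans (s≤s z≤n) x<y

module FirstInTwoCycle {n : ℕ} (t : Fin (suc n)) where
  open TwoCycle {n} 0F t public

  toℕ-embed-< : ∀ y → toℕ y ℕ.< toℕ t → toℕ (embed y) ≡ suc (toℕ y)
  toℕ-embed-< y y<t = cong suc (toℕ-punchIn-< t y y<t)

  b<embed : ∀ y → toℕ t ≤ toℕ y → b < embed y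
  b<embed y t≤y = s≤s (subst (suc (toℕ t) ≤_) (sym (toℕ-punchIn-≥ t y t≤y)) (s≤s t≤y))

  positive⇒inner : ∀ ρ z → 0 ℕ.< toℕ z → 0 ℕ.< toℕ (extend ρ z) → ∃ λ x → z ≡ embed x
  positive⇒inner ρ z 0<z 0<πz with position z
  ... | at-a with () ← 0<z
  ... | at-b with () ← subst (λ v → 0 ℕ.< toℕ v) (extend-b ρ) 0<πz
  ... | inner x = x , refl

  -- A large ascent bottom of ρ would form a second 123 with the first position, whose value is t + 1.
  extend-unique123⁻¹ : ∀ {ρ} → Involutive ρ → Unique123 (extend ρ) → Unique123 ρ × AscentsBelow ρ (toℕ t)
  extend-unique123⁻¹ {ρ} inv ((p , q , r) , occ , unique)
    with extend-fixed⇒inner ρ p p-fixed | extend-fixed⇒inner ρ q q-fixed | extend-fixed⇒inner ρ r r-fixed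
    where open UniqueOccurrence (extend-involutive inv) occ unique
  ... | p′ , refl | q′ , refl | r′ , refl =
    ((p′ , q′ , r′) , extend-occ⁻¹ ρ occ , λ o occ′ → embed³-injective (unique _ (extend-occ ρ occ′))) , ascents
    where
    ascents : AscentsBelow ρ (toℕ t)
    ascents i j i<j ρi<ρj with toℕ (ρ i) ℕ.<? toℕ t
    ... | yes ρi<t = ρi<t
    ... | no ρi≮t with unique (0F , embed i , embed j) (s≤s z≤n , embed-mono-< i<j ,
                             subst₂ _<_ (sym (extend-a ρ)) (sym (extend-embed ρ i)) (b<embed (ρ i) (≮⇒≥ ρi≮t)) ,
                             extend-embed-mono-< ρ ρi<ρj)
    ...   | ()

  extend-unique123 : ∀ {ρ} → Involutive ρ → Unique123 ρ → AscentsBelow ρ (toℕ t) → Unique123 (extend ρ)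
  extend-unique123 {ρ} inv (o , occ , unique) asc = embed³ o , extend-occ ρ occ , unique′
    where
    unique′ : ∀ o′ → Occ123 (extend ρ) o′ → o′ ≡ embed³ o
    unique′ (x , y , z) occ′@(x<y , y<z , πx<πy , πy<πz)
      with positive⇒inner ρ y (toℕ-pos x<y) (toℕ-pos πx<πy) | positive⇒inner ρ z (toℕ-pos y<z) (toℕ-pos πy<πz)
    ... | y′ , refl | z′ , refl with position x
    ...   | at-a = ⊥-elim (<-asym ρy′<t (subst (toℕ t ℕ.<_) (toℕ-punchIn-< t (ρ y′) ρy′<t) b<πy′))
      where
      b<πy′ : toℕ t ℕ.< toℕ (punchIn t (ρ y′))
      b<πy′ = ≤-pred (subst₂ _<_ (extend-a ρ) (extend-embed ρ y′) πx<πy)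
      ρy′<t : toℕ (ρ y′) ℕ.< toℕ t
      ρy′<t = asc y′ z′ (embed-cancel-< y<z) (extend-embed-cancel-< ρ πy<πz)
    ...   | at-b = ⊥-elim (<⇒≱ y′<t t≤y′)
      where
      t≤y′ : toℕ t ≤ toℕ y′
      t≤y′ with toℕ y′ ℕ.<? toℕ t
      ... | yes y′<t = ⊥-elim (<-asym y′<t (subst (toℕ t ℕ.<_) (toℕ-punchIn-< t y′ y′<t) (≤-pred x<y)))
      ... | no y′≮t = ≮⇒≥ y′≮t
      y′<t : toℕ y′ ℕ.< toℕ t
      y′<t = subst (λ v → toℕ v ℕ.< toℕ t) (inv y′)
               (asc (ρ y′) (ρ z′) (extend-embed-cancel-< ρ πy<πz) (subst₂ _<_ (sym (inv y′)) (sym (inv z′)) (embed-cancel-< y<z)))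
    ...   | inner x′ = cong embed³ (unique _ (extend-occ⁻¹ ρ occ′))

  extend-ascentsBelow⁻¹-inner : ∀ {ρ} → Involutive ρ → toℕ t ℕ.< n →
    ∀ {u} → AscentsBelow (extend ρ) u → suc (toℕ t) ℕ.< u
  extend-ascentsBelow⁻¹-inner {ρ} inv t<n {u} asc = subst (ℕ._< u) (cong toℕ (extend-a ρ)) (asc 0F j 0<j πj-large)
    where
    last : Fin (suc (suc n))
    last = fromℕ (suc n)
    j : Fin (suc (suc n))
    j = extend ρ last
    0<j : Fin.zero {suc n} < j
    0<j with j ≟ᶠ 0F
    ... | no j≢0 = ≤∧≢⇒< z≤n (j≢0 ∘ toℕ-injective ∘ sym)
    ... | yes j≡0 = ⊥-elim (<-irrefl (suc-injective (trans (cong toℕ (trans (sym (extend-a ρ))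
                      (trans (cong (extend ρ) (sym j≡0)) (extend-involutive inv last)))) (Fₚ.toℕ-fromℕ (suc n)))) t<n)
    πj-large : extend ρ 0F < extend ρ j
    πj-large = subst₂ _<_ (sym (extend-a ρ)) (sym (extend-involutive inv last))
                 (subst (suc (toℕ t) ℕ.<_) (sym (Fₚ.toℕ-fromℕ (suc n))) (s≤s t<n))

  extend-ascentsBelow-inner : ∀ {ρ} → AscentsBelow ρ (toℕ t) → ∀ {u} → suc (toℕ t) ℕ.< u → AscentsBelow (extend ρ) u
  extend-ascentsBelow-inner {ρ} asc {u} b<u x y x<y πx<πy with position x
  ... | at-a = subst (ℕ._< u) (sym (cong toℕ (extend-a ρ))) b<u
  ... | at-b = subst (ℕ._< u) (sym (cong toℕ (extend-b ρ))) (≤-trans (s≤s z≤n) b<u)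
  ... | inner x′ with positive⇒inner ρ y (toℕ-pos x<y) (toℕ-pos πx<πy)
  ...   | y′ , refl = subst (ℕ._< u) (sym (trans (cong toℕ (extend-embed ρ x′)) (toℕ-embed-< (ρ x′) ρx′<t)))
                          (<-trans (s≤s ρx′<t) b<u)
    where
    ρx′<t : toℕ (ρ x′) ℕ.< toℕ t
    ρx′<t = asc x′ y′ (embed-cancel-< x<y) (extend-embed-cancel-< ρ πx<πy)

  module _ (t≡n : toℕ t ≡ n) where

    private
      toℕ-embed : ∀ y → toℕ (embed y) ≡ suc (toℕ y)
      toℕ-embed y = toℕ-embed-< y (subst (toℕ y ℕ.<_) (sym t≡n) (toℕ<n y))

      below-b : ∀ (z : Fin (suc (suc n))) → toℕ z ≤ toℕ b
      below-b z = subst (toℕ z ≤_) (cong suc (sym t≡n)) (≤-pred (toℕ<n z))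

    extend-ascentsBelow⁻¹-last : ∀ {ρ u} → AscentsBelow (extend ρ) (suc u) → AscentsBelow ρ u
    extend-ascentsBelow⁻¹-last {ρ} {u} asc i j i<j ρi<ρj =
      ≤-pred (subst (ℕ._< suc u) (trans (cong toℕ (extend-embed ρ i)) (toℕ-embed (ρ i)))
               (asc (embed i) (embed j) (embed-mono-< i<j) (extend-embed-mono-< ρ ρi<ρj)))

    extend-ascentsBelow-last : ∀ {ρ u} → AscentsBelow ρ u → AscentsBelow (extend ρ) (suc u)
    extend-ascentsBelow-last {ρ} {u} asc x y x<y πx<πy with position x
    ... | at-a = ⊥-elim (<⇒≱ (subst (ℕ._< toℕ (extend ρ y)) (cong toℕ (extend-a ρ)) πx<πy) (below-b (extend ρ y)))
    ... | at-b = ⊥-elim (<⇒≱ x<y (below-b y))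
    ... | inner x′ with positive⇒inner ρ y (toℕ-pos x<y) (toℕ-pos πx<πy)
    ...   | y′ , refl = subst (ℕ._< suc u) (sym (trans (cong toℕ (extend-embed ρ x′)) (toℕ-embed (ρ x′))))
                          (s≤s (asc x′ y′ (embed-cancel-< x<y) (extend-embed-cancel-< ρ πx<πy)))

module FirstFixed {m : ℕ} where
  open TwoCycle {suc m} 1F (fromℕ (suc m)) public

  ≤b : ∀ (z : Fin (suc (suc (suc m)))) → toℕ z ≤ toℕ b
  ≤b = Fₚ.≤fromℕ

  b≮ : ∀ {z} (w : Fin (suc (suc (suc m)))) → z ≡ b → ¬ (z < w)
  b≮ w refl b<w = <⇒≱ b<w (≤b w)

  private
    toℕ-punchIn-last : ∀ y → toℕ (punchIn (fromℕ (suc m)) y) ≡ toℕ y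
    toℕ-punchIn-last y = toℕ-punchIn-< (fromℕ (suc m)) y (subst (toℕ y ℕ.<_) (sym (Fₚ.toℕ-fromℕ (suc m))) (toℕ<n y))

  toℕ-embed-≤ : ∀ y → toℕ (embed y) ≤ suc (toℕ y)
  toℕ-embed-≤ y = ≤-trans (toℕ-punchIn-≤ 1F _) (s≤s (≤-reflexive (toℕ-punchIn-last y)))

  toℕ-embed-pos : ∀ y → 0 ℕ.< toℕ y → toℕ (embed y) ≡ suc (toℕ y)
  toℕ-embed-pos y 0<y =
    trans (toℕ-punchIn-≥ 1F _ (subst (1 ≤_) (sym (toℕ-punchIn-last y)) 0<y)) (cong suc (toℕ-punchIn-last y))

  extend-unique123⁻¹ : ∀ {ρ} → Involutive ρ → Unique123 (extend ρ) → Unique123 ρ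
  extend-unique123⁻¹ {ρ} inv ((p , q , r) , occ , unique)
    with extend-fixed⇒inner ρ p p-fixed | extend-fixed⇒inner ρ q q-fixed | extend-fixed⇒inner ρ r r-fixed
    where open UniqueOccurrence (extend-involutive inv) occ unique
  ... | p′ , refl | q′ , refl | r′ , refl =
    (p′ , q′ , r′) , extend-occ⁻¹ ρ occ , λ o occ′ → embed³-injective (unique _ (extend-occ ρ occ′))

  extend-unique123 : ∀ {ρ} → Unique123 ρ → Unique123 (extend ρ)
  extend-unique123 {ρ} (o , occ , unique) = embed³ o , extend-occ ρ occ , unique′
    where
    unique′ : ∀ o′ → Occ123 (extend ρ) o′ → o′ ≡ embed³ o
    unique′ (x , y , z) occ′@(x<y , y<z , πx<πy , πy<πz) with position x
    ... | at-a = ⊥-elim (b≮ (extend ρ y) (extend-a ρ) πx<πy)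
    ... | at-b = ⊥-elim (b≮ y refl x<y)
    ... | inner x′ with position y
    ...   | at-a = ⊥-elim (b≮ (extend ρ z) (extend-a ρ) πy<πz)
    ...   | at-b = ⊥-elim (b≮ z refl y<z)
    ...   | inner y′ with position z
    ...     | at-a = ⊥-elim (<⇒≱ x<y (≤-trans (≤-pred y<z) z≤n))
    ...     | at-b = ⊥-elim (<⇒≱ πx<πy (≤-trans (≤-pred πy<a) z≤n))
      where
      πy<a : toℕ (extend ρ (embed y′)) ℕ.< 1
      πy<a = subst (toℕ (extend ρ (embed y′)) ℕ.<_) (cong toℕ (extend-b ρ)) πy<πz
    ...     | inner z′ = cong embed³ (unique _ (extend-occ⁻¹ ρ occ′))

  extend-fixes-0⁻¹ : ∀ ρ → extend ρ 0F ≡ 0F → ρ 0F ≡ 0F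
  extend-fixes-0⁻¹ ρ fixed = embed-injective (trans (sym (extend-embed ρ 0F)) fixed)

  extend-fixes-0 : ∀ ρ → ρ 0F ≡ 0F → extend ρ 0F ≡ 0F
  extend-fixes-0 ρ fixed = trans (extend-embed ρ 0F) (cong embed fixed)

  extend-ascentsBelow⁻¹ : ∀ {ρ u} → AscentsBelow (extend ρ) (suc (suc u)) → AscentsBelow ρ (suc u)
  extend-ascentsBelow⁻¹ {ρ} {u} asc i j i<j ρi<ρj with toℕ (ρ i) ℕ.≟ 0
  ... | yes ρi≡0 = subst (ℕ._< suc u) (sym ρi≡0) (s≤s z≤n)
  ... | no ρi≢0 = ≤-pred (subst (ℕ._< suc (suc u))
                    (trans (cong toℕ (extend-embed ρ i)) (toℕ-embed-pos (ρ i) (n≢0⇒n>0 ρi≢0)))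
                    (asc (embed i) (embed j) (embed-mono-< i<j) (extend-embed-mono-< ρ ρi<ρj)))

  extend-ascentsBelow : ∀ {ρ u} → ρ 0F ≡ 0F → AscentsBelow ρ (suc u) → AscentsBelow (extend ρ) (suc (suc u))
  extend-ascentsBelow {ρ} {u} fixed asc x y x<y πx<πy with position x
  ... | at-a = ⊥-elim (b≮ (extend ρ y) (extend-a ρ) πx<πy)
  ... | at-b = ⊥-elim (b≮ y refl x<y)
  ... | inner x′ with position y
  ...   | at-a = subst (ℕ._< suc (suc u)) (sym (cong toℕ (trans (cong (extend ρ) x≡0) (extend-fixes-0 ρ fixed)))) (s≤s z≤n)
    where
    x≡0 : embed x′ ≡ 0F
    x≡0 = toℕ-injective (n≤0⇒n≡0 (≤-pred x<y))
  ...   | at-b = ≤-trans (subst (toℕ (extend ρ (embed x′)) ℕ.<_) (cong toℕ (extend-b ρ)) πx<πy) (s≤s z≤n)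
  ...   | inner y′ = subst (ℕ._< suc (suc u)) (sym (cong toℕ (extend-embed ρ x′)))
                       (≤-<-trans (toℕ-embed-≤ (ρ x′)) (s≤s (asc x′ y′ (embed-cancel-< x<y) (extend-embed-cancel-< ρ πx<πy))))

-- Counting admissible involutions

Admissible : ∀ {n} → ℕ → Endo n → Set
Admissible t π = Involutive π × Unique123 π × AscentsBelow π t

admissible? : ∀ {n} t (π : Endo n) → Dec (Admissible t π)
admissible? t π = involutive? π ×-dec (unique123? π ×-dec ascentsBelow? π t)

admissible-resp : ∀ {n t} {π π′ : Endo n} → π ≗ π′ → Admissible t π → Admissible t π′
admissible-resp {π = π} {π′} π≗π′ (inv , (o , occ , unique) , asc) =
  (λ i → trans (cong π′ (sym (π≗π′ i))) (trans (sym (π≗π′ (π i))) (inv i))) ,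
  (o , occ-resp π≗π′ occ , λ o′ → unique o′ ∘ occ-resp (sym ∘ π≗π′)) ,
  λ i j i<j πi<πj → subst (λ v → toℕ v ℕ.< _) (π≗π′ i)
                       (asc i j i<j (subst₂ _<_ (sym (π≗π′ i)) (sym (π≗π′ j)) πi<πj))
  where
  occ-resp : ∀ {σ σ′ : Endo _} → σ ≗ σ′ → ∀ {o} → Occ123 σ o → Occ123 σ′ o
  occ-resp σ≗σ′ {a , b , c} (a<b , b<c , σa<σb , σb<σc) =
    a<b , b<c , subst₂ _<_ (σ≗σ′ a) (σ≗σ′ b) σa<σb , subst₂ _<_ (σ≗σ′ b) (σ≗σ′ c) σb<σc

#Admissible : ℕ → ℕ → ℕ
#Admissible n t = #[ admissible? {n} t ]

#Admissible-0 : ∀ n → #Admissible n 0 ≡ 0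
#Admissible-0 n = #-empty {n = n} (admissible? 0)
  (λ π (_ , (_ , occ , _) , asc) → <⇒≱ (occ123⇒ascentsBelow⇒2≤ occ asc) z≤n)

#Admissible-≥ : ∀ n t → n ≤ t → #Admissible n t ≡ #Admissible n n
#Admissible-≥ n t n≤t = #-⇔ {n = n} (admissible? t) (admissible? n)
  (λ π (inv , uniq , _) → inv , uniq , ascentsBelow-≥ π ≤-refl)
  (λ π (inv , uniq , _) → inv , uniq , ascentsBelow-≥ π n≤t)

#MovesFirst : ℕ → ℕ → ℕ
#MovesFirst zero t = 0
#MovesFirst (suc n) t = #[ (λ (π : Endo (suc n)) → admissible? t π ×-dec ¬? (π 0F ≟ᶠ 0F)) ]

#FixesFirst : ℕ → ℕ → ℕ
#FixesFirst zero t = 0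
#FixesFirst (suc n) t = #[ (λ (π : Endo (suc n)) → admissible? t π ×-dec (π 0F ≟ᶠ 0F)) ]

#Admissible-split : ∀ n t → #Admissible (suc n) t ≡ #MovesFirst (suc n) t + #FixesFirst (suc n) t
#Admissible-split n t = trans (∑-cong (allFuns (suc n) (suc n)) (λ π → 𝟙-split (admissible? t π) (π 0F ≟ᶠ 0F)))
  (∑-+ (allFuns (suc n) (suc n)) _ _)

#FixesFirst-0 : ∀ n → #FixesFirst n 0 ≡ 0
#FixesFirst-0 zero = refl
#FixesFirst-0 (suc n) = #-empty {n = suc n} (λ π → admissible? 0 π ×-dec (π 0F ≟ᶠ 0F))
  (λ π ((_ , (_ , occ , _) , asc) , _) → <⇒≱ (occ123⇒ascentsBelow⇒2≤ occ asc) z≤n)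

#FixesFirst-≥ : ∀ n t → n ≤ t → #FixesFirst n t ≡ #FixesFirst n n
#FixesFirst-≥ zero t _ = refl
#FixesFirst-≥ (suc n) t n≤t = #-⇔ {n = suc n}
  (λ π → admissible? t π ×-dec (π 0F ≟ᶠ 0F)) (λ π → admissible? (suc n) π ×-dec (π 0F ≟ᶠ 0F))
  (λ π ((inv , uniq , _) , fixed) → (inv , uniq , ascentsBelow-≥ π ≤-refl) , fixed)
  (λ π ((inv , uniq , _) , fixed) → (inv , uniq , ascentsBelow-≥ π n≤t) , fixed)

predᶠ : ∀ {n} → Fin (suc (suc n)) → Fin (suc n)
predᶠ 0F = 0F
predᶠ (Fin.suc x) = x

suc-predᶠ : ∀ {n} (z : Fin (suc (suc n))) → z ≢ 0F → Fin.suc (predᶠ z) ≡ z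
suc-predᶠ 0F z≢0 = ⊥-elim (z≢0 refl)
suc-predᶠ (Fin.suc z) _ = refl

module MovesFirst (n u : ℕ) where
  open FirstInTwoCycle using (extend; extend-a; restrict)

  Counted : Endo (suc (suc n)) → Set
  Counted π = Admissible u π × π 0F ≢ 0F

  Counted? : ∀ π → Dec (Counted π)
  Counted? π = admissible? u π ×-dec ¬? (π 0F ≟ᶠ 0F)

  Piece : Fin (suc n) → Endo n → Set
  Piece t ρ = Admissible (toℕ t) ρ × AscentsBelow (extend t ρ) u

  Piece? : ∀ t ρ → Dec (Piece t ρ)
  Piece? t ρ = admissible? (toℕ t) ρ ×-dec ascentsBelow? (extend t ρ) u

  index : Endo (suc (suc n)) → Fin (suc n)
  index π = predᶠ (π 0F)

  rest : Endo (suc (suc n)) → Endo n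
  rest π = restrict (index π) π

  counted-resp : ∀ {π π′} → π ≗ π′ → Counted π → Counted π′
  counted-resp π≗π′ (adm , moves) = admissible-resp π≗π′ adm , moves ∘ trans (π≗π′ 0F)

  index-resp : ∀ {π π′} → π ≗ π′ → index π ≡ index π′
  index-resp π≗π′ = cong predᶠ (π≗π′ 0F)

  rest-resp : ∀ {π π′} → π ≗ π′ → rest π ≗ rest π′
  rest-resp {π} {π′} π≗π′ x =
    trans (FirstInTwoCycle.restrict-cong (index π) π≗π′ x) (cong (λ t → restrict t π′ x) (index-resp π≗π′))

  piece⇒counted : ∀ t ρ → Piece t ρ → Counted (extend t ρ)
  piece⇒counted t ρ ((inv , uniq , asc) , asc′) =
    (FirstInTwoCycle.extend-involutive t inv , FirstInTwoCycle.extend-unique123 t inv uniq asc , asc′) ,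
    λ π0≡0 → Fₚ.0≢1+n (trans (sym π0≡0) (extend-a t ρ))

  counted⇒piece : ∀ t ρ → Counted (extend t ρ) → Piece t ρ
  counted⇒piece t ρ ((inv , uniq , asc′) , _) =
    (inv′ , FirstInTwoCycle.extend-unique123⁻¹ t inv′ uniq) , asc′
    where inv′ = FirstInTwoCycle.extend-involutive⁻¹ t inv

  extend-index-rest : ∀ π → Counted π → extend (index π) (rest π) ≗ π
  extend-index-rest π ((inv , _) , moves) = FirstInTwoCycle.extend-restrict (index π) inv (sym (suc-predᶠ (π 0F) moves))

  index-extend : ∀ t ρ → Piece t ρ → index (extend t ρ) ≡ t
  index-extend t ρ _ = cong predᶠ (extend-a t ρ)

  rest-extend : ∀ t ρ → Piece t ρ → rest (extend t ρ) ≗ ρ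
  rest-extend t ρ piece x =
    trans (cong (λ t′ → restrict t′ (extend t ρ) x) (index-extend t ρ piece)) (FirstInTwoCycle.restrict-extend t ρ x)

  open Decomposition Counted? Piece? extend index rest counted-resp FirstInTwoCycle.extend-cong index-resp rest-resp
    piece⇒counted counted⇒piece extend-index-rest index-extend rest-extend public

  fibre-inner : ∀ t → toℕ t ℕ.< n → #[ Piece? t ] ≡ 𝟙 (suc (toℕ t) ℕ.<? u) * #Admissible n (toℕ t)
  fibre-inner t t<n = begin
    #[ Piece? t ]
      ≡⟨ #-⇔ (Piece? t) (λ ρ → admissible? (toℕ t) ρ ×-dec (suc (toℕ t) ℕ.<? u))
             (λ ρ (adm@(inv , _) , asc′) → adm , FirstInTwoCycle.extend-ascentsBelow⁻¹-inner t inv t<n asc′)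
             (λ ρ (adm@(_ , _ , asc) , b<u) → adm , FirstInTwoCycle.extend-ascentsBelow-inner t asc b<u) ⟩
    ∑[ ρ ∈ allFuns n n ] 𝟙 (admissible? (toℕ t) ρ ×-dec (suc (toℕ t) ℕ.<? u))
      ≡⟨ ∑-cong (allFuns n n) (λ ρ → trans (𝟙-× (admissible? (toℕ t) ρ) (suc (toℕ t) ℕ.<? u))
           (*-comm (𝟙 (admissible? (toℕ t) ρ)) _)) ⟩
    ∑[ ρ ∈ allFuns n n ] (𝟙 (suc (toℕ t) ℕ.<? u) * 𝟙 (admissible? (toℕ t) ρ))
      ≡⟨ ∑-*ˡ (allFuns n n) (𝟙 (suc (toℕ t) ℕ.<? u)) (λ ρ → 𝟙 (admissible? (toℕ t) ρ)) ⟩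
    𝟙 (suc (toℕ t) ℕ.<? u) * #Admissible n (toℕ t) ∎
    where open ≡-Reasoning

#MovesFirst-fibre-last : ∀ n u t → toℕ t ≡ n → #[ MovesFirst.Piece? n u t ] ≡ #Admissible n (ℕ.pred u)
#MovesFirst-fibre-last n zero t _ = trans (#-empty {n = n} (MovesFirst.Piece? n 0 t)
  (λ ρ ((inv , uniq , asc) , asc′) →
     <⇒≱ (occ123⇒ascentsBelow⇒2≤ (proj₁ (proj₂ (FirstInTwoCycle.extend-unique123 t inv uniq asc))) asc′) z≤n))
  (sym (#Admissible-0 n))
#MovesFirst-fibre-last n (suc u) t t≡n = #-⇔ {n = n} (MovesFirst.Piece? n (suc u) t) (admissible? u)
  (λ ρ ((inv , uniq , _) , asc′) → inv , uniq , FirstInTwoCycle.extend-ascentsBelow⁻¹-last t t≡n asc′)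
  (λ ρ (inv , uniq , asc) →
     (inv , uniq , ascentsBelow-≥ ρ (≤-reflexive (sym t≡n))) , FirstInTwoCycle.extend-ascentsBelow-last t t≡n asc)

#MovesFirst-rec : ∀ n u → #MovesFirst (suc (suc n)) u ≡
  ∑[ t ∈ allFin n ] (𝟙 (suc (toℕ t) ℕ.<? u) * #Admissible n (toℕ t)) + #Admissible n (ℕ.pred u)
#MovesFirst-rec n u = begin
  #MovesFirst (suc (suc n)) u
    ≡⟨ MovesFirst.#-decompose n u ⟩
  ∑[ t ∈ allFin (suc n) ] #[ MovesFirst.Piece? n u t ]
    ≡⟨ ∑-allFin-last n _ ⟩
  ∑[ t ∈ allFin n ] #[ MovesFirst.Piece? n u (inject₁ t) ] + #[ MovesFirst.Piece? n u (fromℕ n) ]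
    ≡⟨ cong₂ _+_ (∑-cong (allFin n) inner) (#MovesFirst-fibre-last n u (fromℕ n) (Fₚ.toℕ-fromℕ n)) ⟩
  ∑[ t ∈ allFin n ] (𝟙 (suc (toℕ t) ℕ.<? u) * #Admissible n (toℕ t)) + #Admissible n (ℕ.pred u) ∎
  where
  open ≡-Reasoning
  inner : ∀ t → #[ MovesFirst.Piece? n u (inject₁ t) ] ≡ 𝟙 (suc (toℕ t) ℕ.<? u) * #Admissible n (toℕ t)
  inner t = trans (MovesFirst.fibre-inner n u (inject₁ t) (subst (ℕ._< n) (sym (Fₚ.toℕ-inject₁ t)) (toℕ<n t)))
                  (cong (λ v → 𝟙 (suc v ℕ.<? u) * #Admissible n v) (Fₚ.toℕ-inject₁ t))

module FixesFirst (k u : ℕ) where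
  open FirstFixed {suc k} using (extend; restrict; extend-a)

  Counted : Endo (suc (suc (suc (suc k)))) → Set
  Counted π = Admissible u π × π 0F ≡ 0F

  Counted? : ∀ π → Dec (Counted π)
  Counted? π = admissible? u π ×-dec (π 0F ≟ᶠ 0F)

  Piece : Fin 1 → Endo (suc (suc k)) → Set
  Piece _ ρ = (Involutive ρ × Unique123 ρ × AscentsBelow (extend ρ) u) × ρ 0F ≡ 0F

  Piece? : ∀ t ρ → Dec (Piece t ρ)
  Piece? _ ρ = (involutive? ρ ×-dec (unique123? ρ ×-dec ascentsBelow? (extend ρ) u)) ×-dec (ρ 0F ≟ᶠ 0F)

  counted-resp : ∀ {π π′} → π ≗ π′ → Counted π → Counted π′
  counted-resp π≗π′ (adm , fixed) = admissible-resp π≗π′ adm , trans (sym (π≗π′ 0F)) fixed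

  piece⇒counted : ∀ t ρ → Piece t ρ → Counted (extend ρ)
  piece⇒counted _ ρ ((inv , uniq , asc′) , fixed) =
    (FirstFixed.extend-involutive inv , FirstFixed.extend-unique123 uniq , asc′) , FirstFixed.extend-fixes-0 ρ fixed

  counted⇒piece : ∀ t ρ → Counted (extend ρ) → Piece t ρ
  counted⇒piece _ ρ ((inv , uniq , asc′) , fixed) =
    (inv′ , FirstFixed.extend-unique123⁻¹ inv′ uniq , asc′) , FirstFixed.extend-fixes-0⁻¹ ρ fixed
    where inv′ = FirstFixed.extend-involutive⁻¹ inv

  extend-restrict : ∀ π → Counted π → extend (restrict π) ≗ π
  extend-restrict π ((inv , uniq , _) , fixed) = FirstFixed.extend-restrict inv (fixes-0⇒1↦last inv uniq fixed)

  index-extend : ∀ t ρ → Piece t ρ → 0F ≡ t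
  index-extend 0F _ _ = refl

  rest-extend : ∀ t ρ → Piece t ρ → restrict (extend ρ) ≗ ρ
  rest-extend _ ρ _ = FirstFixed.restrict-extend ρ

  open Decomposition Counted? Piece? (const extend) (const 0F) restrict counted-resp (const FirstFixed.extend-cong)
    (const refl) FirstFixed.restrict-cong piece⇒counted counted⇒piece extend-restrict index-extend rest-extend public

#FixesFirst-rec : ∀ k u → #FixesFirst (suc (suc (suc (suc k)))) (suc u) ≡ #FixesFirst (suc (suc k)) u
#FixesFirst-rec k zero = begin
  #FixesFirst (suc (suc (suc (suc k)))) 1
    ≡⟨ FixesFirst.#-decompose k 1 ⟩
  #[ FixesFirst.Piece? k 1 0F ] + 0
    ≡⟨ cong (_+ 0) (#-empty {n = suc (suc k)} (FixesFirst.Piece? k 1 0F) (λ ρ ((_ , uniq , asc′) , _) →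
         <⇒≱ (occ123⇒ascentsBelow⇒2≤ (proj₁ (proj₂ (FirstFixed.extend-unique123 uniq))) asc′) (s≤s z≤n))) ⟩
  0
    ≡⟨ #FixesFirst-0 (suc (suc k)) ⟨
  #FixesFirst (suc (suc k)) 0 ∎
  where open ≡-Reasoning
#FixesFirst-rec k (suc u) = begin
  #FixesFirst (suc (suc (suc (suc k)))) (suc (suc u))
    ≡⟨ FixesFirst.#-decompose k (suc (suc u)) ⟩
  #[ FixesFirst.Piece? k (suc (suc u)) 0F ] + 0
    ≡⟨ +-identityʳ _ ⟩
  #[ FixesFirst.Piece? k (suc (suc u)) 0F ]
    ≡⟨ #-⇔ {n = suc (suc k)} (FixesFirst.Piece? k (suc (suc u)) 0F) (λ ρ → admissible? (suc u) ρ ×-dec (ρ 0F ≟ᶠ 0F))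
         (λ ρ ((inv , uniq , asc′) , fixed) → (inv , uniq , FirstFixed.extend-ascentsBelow⁻¹ asc′) , fixed)
         (λ ρ ((inv , uniq , asc) , fixed) → (inv , uniq , FirstFixed.extend-ascentsBelow fixed asc) , fixed) ⟩
  #FixesFirst (suc (suc k)) (suc u) ∎
  where open ≡-Reasoning

#FixesFirst-3 : ∀ t → #FixesFirst 3 t ≡ 𝟙 (2 ℕ.≤? t)
#FixesFirst-3 0 = refl
#FixesFirst-3 1 = refl
#FixesFirst-3 2 = refl
#FixesFirst-3 (suc (suc (suc t))) = #FixesFirst-≥ 3 (3 + t) (s≤s (s≤s (s≤s z≤n)))

#Admissible-3 : ∀ t → #Admissible 3 t ≡ 𝟙 (2 ℕ.≤? t)
#Admissible-3 0 = refl
#Admissible-3 1 = refl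
#Admissible-3 2 = refl
#Admissible-3 (suc (suc (suc t))) = #Admissible-≥ 3 (3 + t) (s≤s (s≤s (s≤s z≤n)))

-- The ballot triangle

odd : ℕ → ℕ
odd zero = 1
odd (suc h) = suc (suc (odd h))

oddSize : ℕ → ℕ
oddSize h = suc (suc (odd h))

odd≡ : ∀ h → odd h ≡ suc (h * 2)
odd≡ zero = refl
odd≡ (suc h) = cong (suc ∘ suc) (odd≡ h)

oddSize≡1+[1+h]+[1+h] : ∀ h → oddSize h ≡ suc (suc h + suc h)
oddSize≡1+[1+h]+[1+h] h = trans (cong (suc ∘ suc) (odd≡ h)) (3+h*2≡1+[1+h]+[1+h] h)
  where
  3+h*2≡1+[1+h]+[1+h] : ∀ h → 3 + h * 2 ≡ 1 + (1 + h) + (1 + h)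
  3+h*2≡1+[1+h]+[1+h] = solve-∀

oddSize≡[1+h]+[2+h] : ∀ h → oddSize h ≡ suc h + suc (suc h)
oddSize≡[1+h]+[2+h] h = trans (oddSize≡1+[1+h]+[1+h] h) (cong suc (sym (+-suc h (suc h))))

#FixesFirst-oddSize : ∀ h t → #FixesFirst (oddSize h) t ≡ 𝟙 (suc (suc h) ℕ.≤? t)
#FixesFirst-oddSize zero t = #FixesFirst-3 t
#FixesFirst-oddSize (suc h) zero = #FixesFirst-0 (oddSize (suc h))
#FixesFirst-oddSize (suc h) (suc t) =
  trans (#FixesFirst-rec (odd h) t)
    (trans (#FixesFirst-oddSize h t) (𝟙-⇔ (suc (suc h) ℕ.≤? t) (suc (suc (suc h)) ℕ.≤? suc t) s≤s ≤-pred))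

tailSum : ℕ → ℕ → ℕ
tailSum h u = ∑[ s ∈ allFin (oddSize h) ] (𝟙 (suc (toℕ s) ℕ.<? u) * #Admissible (oddSize h) (toℕ s))

#Admissible-oddSize-suc : ∀ h u → #Admissible (oddSize (suc h)) u ≡
  𝟙 (suc (suc (suc h)) ℕ.≤? u) + tailSum h u + #Admissible (oddSize h) (ℕ.pred u)
#Admissible-oddSize-suc h u = begin
  #Admissible (oddSize (suc h)) u
    ≡⟨ #Admissible-split (suc (oddSize h)) u ⟩
  #MovesFirst (oddSize (suc h)) u + #FixesFirst (oddSize (suc h)) u
    ≡⟨ cong₂ _+_ (#MovesFirst-rec (oddSize h) u) (#FixesFirst-oddSize (suc h) u) ⟩
  tailSum h u + #Admissible (oddSize h) (ℕ.pred u) + 𝟙 (suc (suc (suc h)) ℕ.≤? u)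
    ≡⟨ rotate (tailSum h u) _ _ ⟩
  𝟙 (suc (suc (suc h)) ℕ.≤? u) + tailSum h u + #Admissible (oddSize h) (ℕ.pred u) ∎
  where
  open ≡-Reasoning
  rotate : ∀ a b c → a + b + c ≡ c + a + b
  rotate = solve-∀

#Admissible-oddSize-small : ∀ h t → t ≤ suc h → #Admissible (oddSize h) t ≡ 0
tailSum-small : ∀ h t → t ≤ suc (suc (suc h)) → tailSum h t ≡ 0

#Admissible-oddSize-small zero t t≤1 = trans (#Admissible-3 t) (𝟙-no (2 ℕ.≤? t) (λ 2≤t → <⇒≱ 2≤t t≤1))
#Admissible-oddSize-small (suc h) t t≤2+h = begin
  #Admissible (oddSize (suc h)) t
    ≡⟨ #Admissible-oddSize-suc h t ⟩
  𝟙 (suc (suc (suc h)) ℕ.≤? t) + tailSum h t + #Admissible (oddSize h) (ℕ.pred t)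
    ≡⟨ cong₂ _+_ (cong₂ _+_ (𝟙-no (suc (suc (suc h)) ℕ.≤? t) (λ 3+h≤t → <⇒≱ 3+h≤t t≤2+h))
                            (tailSum-small h t (≤-trans t≤2+h (n≤1+n _))))
                 (#Admissible-oddSize-small h (ℕ.pred t) (pred-mono-≤ t≤2+h)) ⟩
  0 ∎
  where open ≡-Reasoning

tailSum-small h t t≤3+h = ∑-zero (allFin (oddSize h)) term-zero
  where
  term-zero : ∀ s → 𝟙 (suc (toℕ s) ℕ.<? t) * #Admissible (oddSize h) (toℕ s) ≡ 0
  term-zero s with suc (toℕ s) ℕ.<? t
  ... | yes s+1<t = trans (+-identityʳ _) (#Admissible-oddSize-small h (toℕ s) (≤-pred (≤-pred (≤-trans s+1<t t≤3+h))))
  ... | no _ = refl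

∑-allFin-toℕ≟ : ∀ n u (f : ℕ → ℕ) → ∑[ s ∈ allFin n ] (𝟙 (toℕ s ℕ.≟ u) * f (toℕ s)) ≡ 𝟙 (u ℕ.<? n) * f u
∑-allFin-toℕ≟ zero u f = refl
∑-allFin-toℕ≟ (suc n) zero f = begin
  ∑[ s ∈ allFin (suc n) ] (𝟙 (toℕ s ℕ.≟ 0) * f (toℕ s))
    ≡⟨ ∑-allFin-suc n (λ s → 𝟙 (toℕ s ℕ.≟ 0) * f (toℕ s)) ⟩
  f 0 + 0 + ∑[ s ∈ allFin n ] (𝟙 (suc (toℕ s) ℕ.≟ 0) * f (suc (toℕ s)))
    ≡⟨ cong (f 0 + 0 +_) (∑-zero (allFin n) (λ s → cong (_* f (suc (toℕ s))) (𝟙-no (suc (toℕ s) ℕ.≟ 0) λ ()))) ⟩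
  f 0 + 0 + 0
    ≡⟨ +-identityʳ _ ⟩
  f 0 + 0 ∎
  where open ≡-Reasoning
∑-allFin-toℕ≟ (suc n) (suc u) f = begin
  ∑[ s ∈ allFin (suc n) ] (𝟙 (toℕ s ℕ.≟ suc u) * f (toℕ s))
    ≡⟨ ∑-allFin-suc n (λ s → 𝟙 (toℕ s ℕ.≟ suc u) * f (toℕ s)) ⟩
  ∑[ s ∈ allFin n ] (𝟙 (suc (toℕ s) ℕ.≟ suc u) * f (suc (toℕ s)))
    ≡⟨ ∑-cong (allFin n) (λ s → cong (_* f (suc (toℕ s)))
         (𝟙-⇔ (suc (toℕ s) ℕ.≟ suc u) (toℕ s ℕ.≟ u) suc-injective (cong suc))) ⟩
  ∑[ s ∈ allFin n ] (𝟙 (toℕ s ℕ.≟ u) * f (suc (toℕ s)))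
    ≡⟨ ∑-allFin-toℕ≟ n u (f ∘ suc) ⟩
  𝟙 (u ℕ.<? n) * f (suc u)
    ≡⟨ cong (_* f (suc u)) (𝟙-⇔ (u ℕ.<? n) (suc u ℕ.<? suc n) s≤s ≤-pred) ⟩
  𝟙 (suc u ℕ.<? suc n) * f (suc u) ∎
  where open ≡-Reasoning

∑-allFin-𝟙<-suc : ∀ n u (f : ℕ → ℕ) →
  ∑[ s ∈ allFin n ] (𝟙 (suc (toℕ s) ℕ.<? suc (suc u)) * f (toℕ s)) ≡
  ∑[ s ∈ allFin n ] (𝟙 (suc (toℕ s) ℕ.<? suc u) * f (toℕ s)) + 𝟙 (u ℕ.<? n) * f u
∑-allFin-𝟙<-suc n u f = begin
  ∑[ s ∈ allFin n ] (𝟙 (suc (toℕ s) ℕ.<? suc (suc u)) * f (toℕ s))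
    ≡⟨ ∑-cong (allFin n) (λ s → cong (_* f (toℕ s)) (≤-split (toℕ s))) ⟩
  ∑[ s ∈ allFin n ] ((𝟙 (suc (toℕ s) ℕ.<? suc u) + 𝟙 (toℕ s ℕ.≟ u)) * f (toℕ s))
    ≡⟨ ∑-cong (allFin n) (λ s → *-distribʳ-+ (f (toℕ s)) (𝟙 (suc (toℕ s) ℕ.<? suc u)) _) ⟩
  ∑[ s ∈ allFin n ] (𝟙 (suc (toℕ s) ℕ.<? suc u) * f (toℕ s) + 𝟙 (toℕ s ℕ.≟ u) * f (toℕ s))
    ≡⟨ ∑-+ (allFin n) _ _ ⟩
  ∑[ s ∈ allFin n ] (𝟙 (suc (toℕ s) ℕ.<? suc u) * f (toℕ s)) + ∑[ s ∈ allFin n ] (𝟙 (toℕ s ℕ.≟ u) * f (toℕ s))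
    ≡⟨ cong (∑[ s ∈ allFin n ] (𝟙 (suc (toℕ s) ℕ.<? suc u) * f (toℕ s)) +_) (∑-allFin-toℕ≟ n u f) ⟩
  ∑[ s ∈ allFin n ] (𝟙 (suc (toℕ s) ℕ.<? suc u) * f (toℕ s)) + 𝟙 (u ℕ.<? n) * f u ∎
  where
  open ≡-Reasoning
  ≤-split : ∀ x → 𝟙 (suc x ℕ.<? suc (suc u)) ≡ 𝟙 (suc x ℕ.<? suc u) + 𝟙 (x ℕ.≟ u)
  ≤-split x with <-cmp x u
  ... | tri< x<u x≢u _ = trans (𝟙-yes (suc x ℕ.<? suc (suc u)) (s≤s (<⇒≤ (s≤s x<u))))
                               (sym (cong₂ _+_ (𝟙-yes (suc x ℕ.<? suc u) (s≤s x<u)) (𝟙-no (x ℕ.≟ u) x≢u)))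
  ... | tri≈ x≮u x≡u _ = trans (𝟙-yes (suc x ℕ.<? suc (suc u)) (s≤s (s≤s (≤-reflexive x≡u))))
                               (sym (cong₂ _+_ (𝟙-no (suc x ℕ.<? suc u) (x≮u ∘ ≤-pred)) (𝟙-yes (x ℕ.≟ u) x≡u)))
  ... | tri> _ x≢u u<x = trans (𝟙-no (suc x ℕ.<? suc (suc u)) (λ x<u+1 → <⇒≱ u<x (≤-pred (≤-pred x<u+1))))
                               (sym (cong₂ _+_ (𝟙-no (suc x ℕ.<? suc u) (λ x<u → <-asym u<x (≤-pred x<u))) (𝟙-no (x ℕ.≟ u) x≢u)))

-- Comparing the recurrence at consecutive bounds cancels the tail sums.
#Admissible-oddSize-step : ∀ h u → suc (suc h) ≤ u →
  #Admissible (oddSize (suc h)) (suc (suc u)) + #Admissible (oddSize h) u ≡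
  #Admissible (oddSize (suc h)) (suc u) + #Admissible (oddSize h) (suc u) + 𝟙 (u ℕ.<? oddSize h) * #Admissible (oddSize h) u
#Admissible-oddSize-step h u h+2≤u = begin
  f′ (suc (suc u)) + f u
    ≡⟨ cong (_+ f u) (#Admissible-oddSize-suc h (suc (suc u))) ⟩
  𝟙 (suc (suc (suc h)) ℕ.≤? suc (suc u)) + tailSum h (suc (suc u)) + f (suc u) + f u
    ≡⟨ cong (λ x → x + tailSum h (suc (suc u)) + f (suc u) + f u)
         (𝟙-yes (suc (suc (suc h)) ℕ.≤? suc (suc u)) (s≤s (m≤n⇒m≤1+n h+2≤u))) ⟩
  1 + tailSum h (suc (suc u)) + f (suc u) + f u
    ≡⟨ cong (λ x → 1 + x + f (suc u) + f u) (∑-allFin-𝟙<-suc (oddSize h) u f) ⟩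
  1 + (tailSum h (suc u) + δ * f u) + f (suc u) + f u
    ≡⟨ regroup (tailSum h (suc u)) (δ * f u) (f (suc u)) (f u) ⟩
  1 + tailSum h (suc u) + f u + f (suc u) + δ * f u
    ≡⟨ cong (λ x → x + tailSum h (suc u) + f u + f (suc u) + δ * f u) (𝟙-yes (suc (suc (suc h)) ℕ.≤? suc u) (s≤s h+2≤u)) ⟨
  𝟙 (suc (suc (suc h)) ℕ.≤? suc u) + tailSum h (suc u) + f u + f (suc u) + δ * f u
    ≡⟨ cong (λ x → x + f (suc u) + δ * f u) (#Admissible-oddSize-suc h (suc u)) ⟨
  f′ (suc u) + f (suc u) + δ * f u ∎
  where
  open ≡-Reasoning
  f f′ : ℕ → ℕ
  f = #Admissible (oddSize h)
  f′ = #Admissible (oddSize (suc h))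
  δ = 𝟙 (u ℕ.<? oddSize h)
  regroup : ∀ s x y z → 1 + (s + x) + y + z ≡ 1 + s + z + y + x
  regroup = solve-∀

ballot : ℕ → ℕ → ℕ
ballot h j = #Admissible (oddSize h) (j + suc (suc h))

ballot-zero : ∀ h → ballot h 0 ≡ suc h
ballot-zero zero = refl
ballot-zero (suc h) = begin
  #Admissible (oddSize (suc h)) (suc (suc (suc h)))
    ≡⟨ #Admissible-oddSize-suc h (suc (suc (suc h))) ⟩
  𝟙 (suc (suc (suc h)) ℕ.≤? suc (suc (suc h))) + tailSum h (suc (suc (suc h))) + ballot h 0
    ≡⟨ cong₂ _+_ (cong₂ _+_ (𝟙-yes (suc (suc (suc h)) ℕ.≤? suc (suc (suc h))) ≤-refl) (tailSum-small h _ ≤-refl))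
                 (ballot-zero h) ⟩
  suc (suc h) ∎
  where open ≡-Reasoning

ballot-step : ∀ h j → ballot (suc h) (suc j) + ballot h j ≡
  ballot (suc h) j + ballot h (suc j) + 𝟙 (j + suc (suc h) ℕ.<? oddSize h) * ballot h j
ballot-step h j =
  subst₂ (λ x y → #Admissible (oddSize (suc h)) x + ballot h j ≡
                  #Admissible (oddSize (suc h)) y + ballot h (suc j) + 𝟙 (j + suc (suc h) ℕ.<? oddSize h) * ballot h j)
    (cong suc (sym (+-suc j (suc (suc h))))) (sym (+-suc j (suc (suc h))))
    (#Admissible-oddSize-step h (j + suc (suc h)) (m≤n+m (suc (suc h)) j))

ballot-pascal : ∀ h j → j ≤ h → ballot (suc h) (suc j) ≡ ballot (suc h) j + ballot h (suc j)
ballot-pascal h j j≤h = +-cancelʳ-≡ (ballot h j) _ _ (begin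
  ballot (suc h) (suc j) + ballot h j
    ≡⟨ ballot-step h j ⟩
  ballot (suc h) j + ballot h (suc j) + 𝟙 (j + suc (suc h) ℕ.<? oddSize h) * ballot h j
    ≡⟨ cong (λ x → ballot (suc h) j + ballot h (suc j) + x * ballot h j) (𝟙-yes (j + suc (suc h) ℕ.<? oddSize h) inside) ⟩
  ballot (suc h) j + ballot h (suc j) + 1 * ballot h j
    ≡⟨ cong (ballot (suc h) j + ballot h (suc j) +_) (*-identityˡ _) ⟩
  ballot (suc h) j + ballot h (suc j) + ballot h j ∎)
  where
  open ≡-Reasoning
  inside : j + suc (suc h) ℕ.< oddSize h
  inside = subst (j + suc (suc h) ℕ.<_) (sym (oddSize≡1+[1+h]+[1+h] h))
             (s≤s (subst (j + suc (suc h) ≤_) (+-suc h (suc h)) (+-monoˡ-≤ (suc (suc h)) j≤h)))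

ballot-cap : ∀ h → ballot (suc h) (suc (suc h)) ≡ ballot (suc h) (suc h)
ballot-cap h = +-cancelʳ-≡ (ballot h (suc h)) _ _ (begin
  ballot (suc h) (suc (suc h)) + ballot h (suc h)
    ≡⟨ ballot-step h (suc h) ⟩
  ballot (suc h) (suc h) + ballot h (suc (suc h)) + 𝟙 (suc h + suc (suc h) ℕ.<? oddSize h) * ballot h (suc h)
    ≡⟨ cong₂ (λ x y → ballot (suc h) (suc h) + x + y * ballot h (suc h)) saturated
         (𝟙-no (suc h + suc (suc h) ℕ.<? oddSize h) (<-irrefl (sym (oddSize≡[1+h]+[2+h] h)))) ⟩
  ballot (suc h) (suc h) + ballot h (suc h) + 0
    ≡⟨ +-identityʳ _ ⟩
  ballot (suc h) (suc h) + ballot h (suc h) ∎)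
  where
  open ≡-Reasoning
  saturated : ballot h (suc (suc h)) ≡ ballot h (suc h)
  saturated = trans (#Admissible-≥ (oddSize h) _ (≤-trans (≤-reflexive (oddSize≡[1+h]+[2+h] h)) (n≤1+n _)))
                    (cong (#Admissible (oddSize h)) (oddSize≡[1+h]+[2+h] h))

[k+1]*[n+1]C[k+1]≡[n+1]*nCk : ∀ n k → suc k * (suc n C suc k) ≡ suc n * (n C k)
[k+1]*[n+1]C[k+1]≡[n+1]*nCk zero zero = refl
[k+1]*[n+1]C[k+1]≡[n+1]*nCk zero (suc k) = begin
  suc (suc k) * (1 C suc (suc k))   ≡⟨ cong (suc (suc k) *_) (k>n⇒nCk≡0 {1} {suc (suc k)} (s≤s (s≤s z≤n))) ⟩
  suc (suc k) * 0                   ≡⟨ *-zeroʳ (suc (suc k)) ⟩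
  0                                 ≡⟨ cong (1 *_) (k>n⇒nCk≡0 {0} {suc k} (s≤s z≤n)) ⟨
  1 * (0 C suc k) ∎
  where open ≡-Reasoning
[k+1]*[n+1]C[k+1]≡[n+1]*nCk (suc n) zero = trans (*-identityˡ _) (trans (nC1≡n (suc (suc n))) (sym (*-identityʳ (suc (suc n)))))
[k+1]*[n+1]C[k+1]≡[n+1]*nCk (suc n) (suc k) = begin
  suc (suc k) * (suc (suc n) C suc (suc k))
    ≡⟨ cong (suc (suc k) *_) (nCk+nC[k+1]≡[n+1]C[k+1] (suc n) (suc k)) ⟨
  suc (suc k) * (X + Y)
    ≡⟨ expand k X Y ⟩
  X + suc k * X + suc (suc k) * Y
    ≡⟨ cong₂ (λ u v → X + u + v) ([k+1]*[n+1]C[k+1]≡[n+1]*nCk n k) ([k+1]*[n+1]C[k+1]≡[n+1]*nCk n (suc k)) ⟩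
  X + suc n * (n C k) + suc n * (n C suc k)
    ≡⟨ +-assoc X _ _ ⟩
  X + (suc n * (n C k) + suc n * (n C suc k))
    ≡⟨ cong (X +_) (*-distribˡ-+ (suc n) (n C k) (n C suc k)) ⟨
  X + suc n * (n C k + n C suc k)
    ≡⟨ cong (λ v → X + suc n * v) (nCk+nC[k+1]≡[n+1]C[k+1] n k) ⟩
  suc (suc n) * X ∎
  where
  open ≡-Reasoning
  X = suc n C suc k
  Y = suc n C suc (suc k)
  expand : ∀ k X Y → suc (suc k) * (X + Y) ≡ X + suc k * X + suc (suc k) * Y
  expand = solve-∀

ballot⁺ : ℕ → ℕ → ℕ
ballot⁺ H j = (H + j) C suc j

ballot⁻ : ℕ → ℕ → ℕ
ballot⁻ H zero = 0
ballot⁻ H (suc zero) = 0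
ballot⁻ H (suc (suc j)) = (H + suc (suc j)) C j

ballot⁺-pascal : ∀ H j → ballot⁺ (suc H) (suc j) ≡ ballot⁺ (suc H) j + ballot⁺ H (suc j)
ballot⁺-pascal H j = trans (sym (nCk+nC[k+1]≡[n+1]C[k+1] (H + suc j) (suc j)))
  (cong (λ m → m C suc j + ballot⁺ H (suc j)) (+-suc H j))

ballot⁻-pascal : ∀ H j → ballot⁻ (suc H) (suc j) ≡ ballot⁻ (suc H) j + ballot⁻ H (suc j)
ballot⁻-pascal H zero = refl
ballot⁻-pascal H (suc zero) = refl
ballot⁻-pascal H (suc (suc j)) = trans (sym (nCk+nC[k+1]≡[n+1]C[k+1] (H + suc (suc (suc j))) j))
  (cong (λ m → m C j + ballot⁻ H (suc (suc (suc j)))) (+-suc H (suc (suc j))))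

ballot±-cap : ∀ h → ballot⁺ (suc (suc h)) (suc (suc h)) + ballot⁻ (suc (suc h)) (suc h) ≡
                    ballot⁺ (suc (suc h)) (suc h) + ballot⁻ (suc (suc h)) (suc (suc h))
ballot±-cap zero = refl
ballot±-cap (suc g) = begin
  (H + H) C suc (suc (suc h)) + ballot⁻ H (suc h)
    ≡⟨ cong (λ m → m C suc (suc (suc h)) + ballot⁻ H (suc h)) H+H≡1+M ⟩
  suc M C suc (suc (suc h)) + M C g
    ≡⟨ cong (_+ M C g) (nCk+nC[k+1]≡[n+1]C[k+1] M (suc (suc h))) ⟨
  M C suc (suc h) + M C suc (suc (suc h)) + M C g
    ≡⟨ cong (λ v → M C suc (suc h) + v + M C g) symmetric ⟩
  M C suc (suc h) + M C h + M C g
    ≡⟨ swap-last (M C suc (suc h)) (M C h) (M C g) ⟩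
  M C suc (suc h) + (M C g + M C h)
    ≡⟨ cong (M C suc (suc h) +_) (nCk+nC[k+1]≡[n+1]C[k+1] M g) ⟩
  M C suc (suc h) + suc M C h
    ≡⟨ cong (λ m → M C suc (suc h) + m C h) H+H≡1+M ⟨
  ballot⁺ H (suc h) + ballot⁻ H H ∎
  where
  open ≡-Reasoning
  h = suc g
  H = suc (suc h)
  M = H + suc h
  H+H≡1+M : H + H ≡ suc M
  H+H≡1+M = cong (suc ∘ suc) (+-suc h (suc h))
  swap-last : ∀ a b c → a + b + c ≡ a + (c + b)
  swap-last = solve-∀
  symmetric : M C suc (suc (suc h)) ≡ M C h
  symmetric = trans (nCk≡nC[n∸k] (subst (suc (suc (suc h)) ≤_) (sym (+-suc H h)) (s≤s (s≤s (s≤s (m≤m+n h h))))))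
                    (cong (M C_) (trans (cong (_∸ suc (suc (suc h))) (+-suc H h)) (m+n∸n≡m h h)))

ballot≡ : ∀ h j → j ≤ suc h → ballot h j + ballot⁻ (suc h) j ≡ ballot⁺ (suc h) j
ballot≡ zero zero _ = refl
ballot≡ zero (suc zero) _ = refl
ballot≡ zero (suc (suc j)) (s≤s ())
ballot≡ (suc h) zero _ = begin
  ballot (suc h) 0 + 0      ≡⟨ +-identityʳ _ ⟩
  ballot (suc h) 0          ≡⟨ ballot-zero (suc h) ⟩
  suc (suc h)               ≡⟨ cong suc (+-identityʳ (suc h)) ⟨
  suc (suc h) + 0           ≡⟨ nC1≡n (suc (suc h) + 0) ⟨
  ballot⁺ (suc (suc h)) 0 ∎
  where open ≡-Reasoning
ballot≡ (suc h) (suc j) (s≤s j≤h+1) with m≤n⇒m<n∨m≡n j≤h+1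
... | inj₁ (s≤s j≤h) = begin
  ballot (suc h) (suc j) + ballot⁻ (suc (suc h)) (suc j)
    ≡⟨ cong₂ _+_ (ballot-pascal h j j≤h) (ballot⁻-pascal (suc h) j) ⟩
  ballot (suc h) j + ballot h (suc j) + (ballot⁻ (suc (suc h)) j + ballot⁻ (suc h) (suc j))
    ≡⟨ interchange (ballot (suc h) j) _ _ _ ⟩
  (ballot (suc h) j + ballot⁻ (suc (suc h)) j) + (ballot h (suc j) + ballot⁻ (suc h) (suc j))
    ≡⟨ cong₂ _+_ (ballot≡ (suc h) j (m≤n⇒m≤1+n j≤h+1)) (ballot≡ h (suc j) (s≤s j≤h)) ⟩
  ballot⁺ (suc (suc h)) j + ballot⁺ (suc h) (suc j)
    ≡⟨ ballot⁺-pascal (suc h) j ⟨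
  ballot⁺ (suc (suc h)) (suc j) ∎
  where open ≡-Reasoning
... | inj₂ refl = +-cancelʳ-≡ (ballot⁻ (suc (suc h)) (suc h)) _ _ (begin
  ballot (suc h) (suc (suc h)) + ballot⁻ (suc (suc h)) (suc (suc h)) + ballot⁻ (suc (suc h)) (suc h)
    ≡⟨ cong (λ x → x + ballot⁻ (suc (suc h)) (suc (suc h)) + ballot⁻ (suc (suc h)) (suc h)) (ballot-cap h) ⟩
  ballot (suc h) (suc h) + ballot⁻ (suc (suc h)) (suc (suc h)) + ballot⁻ (suc (suc h)) (suc h)
    ≡⟨ swap-last (ballot (suc h) (suc h)) _ _ ⟩
  ballot (suc h) (suc h) + ballot⁻ (suc (suc h)) (suc h) + ballot⁻ (suc (suc h)) (suc (suc h))
    ≡⟨ cong (_+ ballot⁻ (suc (suc h)) (suc (suc h))) (ballot≡ (suc h) (suc h) (n≤1+n _)) ⟩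
  ballot⁺ (suc (suc h)) (suc h) + ballot⁻ (suc (suc h)) (suc (suc h))
    ≡⟨ ballot±-cap h ⟨
  ballot⁺ (suc (suc h)) (suc (suc h)) + ballot⁻ (suc (suc h)) (suc h) ∎)
  where
  open ≡-Reasoning
  swap-last : ∀ a b c → a + b + c ≡ a + c + b
  swap-last = solve-∀

oddSize*ballot⁻ : ∀ h → oddSize h * ballot⁻ (suc h) (suc h) ≡ h * (oddSize h C h)
oddSize*ballot⁻ zero = refl
oddSize*ballot⁻ (suc g) = trans (cong (_* ballot⁻ (suc (suc g)) (suc (suc g))) (oddSize≡1+[1+h]+[1+h] (suc g)))
  (trans (sym ([k+1]*[n+1]C[k+1]≡[n+1]*nCk (suc (suc g) + suc (suc g)) g))
         (cong (λ m → suc g * (m C suc g)) (sym (oddSize≡1+[1+h]+[1+h] (suc g)))))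

-- n · (ballot⁺ − ballot⁻) = (h + 3) C(n, h + 3) − h C(n, h) = 3 C(n, h), by absorption and symmetry.
oddSize*ballot : ∀ h → oddSize h * ballot h (suc h) ≡ 3 * (oddSize h C h)
oddSize*ballot h = +-cancelˡ-≡ (h * (N C h)) _ _ (begin
  h * (N C h) + N * G                       ≡⟨ cong (_+ N * G) (oddSize*ballot⁻ h) ⟨
  N * ballot⁻ (suc h) (suc h) + N * G       ≡⟨ +-comm (N * ballot⁻ (suc h) (suc h)) (N * G) ⟩
  N * G + N * ballot⁻ (suc h) (suc h)       ≡⟨ *-distribˡ-+ N G _ ⟨
  N * (G + ballot⁻ (suc h) (suc h))         ≡⟨ cong (N *_) (ballot≡ h (suc h) ≤-refl) ⟩
  N * ballot⁺ (suc h) (suc h)               ≡⟨ cong (_* ballot⁺ (suc h) (suc h)) (oddSize≡1+[1+h]+[1+h] h) ⟩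
  suc M * (M C suc (suc h))                 ≡⟨ [k+1]*[n+1]C[k+1]≡[n+1]*nCk M (suc (suc h)) ⟨
  suc (suc (suc h)) * (suc M C suc (suc (suc h)))
                                            ≡⟨ cong (λ m → suc (suc (suc h)) * (m C suc (suc (suc h)))) (oddSize≡1+[1+h]+[1+h] h) ⟨
  suc (suc (suc h)) * (N C suc (suc (suc h)))
                                            ≡⟨ cong (suc (suc (suc h)) *_) symmetric ⟩
  suc (suc (suc h)) * (N C h)               ≡⟨ trans (cong (_* (N C h)) (+-comm 3 h)) (*-distribʳ-+ (N C h) h 3) ⟩
  h * (N C h) + 3 * (N C h) ∎)
  where
  open ≡-Reasoning
  N = oddSize h
  M = suc h + suc h
  G = ballot h (suc h)
  symmetric : N C suc (suc (suc h)) ≡ N C h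
  symmetric = trans (nCk≡nC[n∸k] (≤-trans (s≤s (s≤s (m≤n+m (suc h) h))) (≤-reflexive (sym (oddSize≡1+[1+h]+[1+h] h)))))
                    (cong (N C_) (trans (cong (_∸ suc (suc (suc h))) (oddSize≡1+[1+h]+[1+h] h)) (m+n∸n≡m h (suc h))))

i≡#Admissible : ∀ n → i n 3 ≡ #Admissible n n
i≡#Admissible n = trans (length-filter≡∑𝟙 (good? 3) (allFuns n n)) (#-⇔ {n = n} (good? 3) (admissible? n)
  (λ π (isInv , _ , once) → IsInvolution⇒Involutive {π = π} isInv , occurrences123≡1⇒Unique123 π once , ascentsBelow-≥ π ≤-refl)
  (λ π (inv , uniq@(_ , occ , unique) , _) →
     Involutive⇒IsInvolution {π = π} inv , UniqueOccurrence.fixedPoints≡3 inv occ unique , Unique123⇒occurrences123≡1 π uniq))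

odd⇒oddSize : ∀ n → 3 ≤ n → n % 2 ≡ 1 → ∃ λ h → n ≡ oddSize h
odd⇒oddSize 1 (s≤s ()) _
odd⇒oddSize 2 (s≤s (s≤s ())) _
odd⇒oddSize 3 _ _ = 0 , refl
odd⇒oddSize 4 _ ()
odd⇒oddSize (suc (suc (suc (suc (suc m))))) _ n-odd with odd⇒oddSize (3 + m) (s≤s (s≤s (s≤s z≤n)))
  (trans (sym (trans (cong (_% 2) (+-comm 2 (3 + m))) ([m+kn]%n≡m%n (3 + m) 1 2))) n-odd)
... | h , 3+m≡oddSize = suc h , cong (suc ∘ suc) 3+m≡oddSize

oddSize*i : ∀ h → oddSize h * i (oddSize h) 3 ≡ 3 * (oddSize h C ((oddSize h ∸ 3) / 2))
oddSize*i h = begin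
  N * i N 3                ≡⟨ cong (N *_) (i≡#Admissible N) ⟩
  N * #Admissible N N      ≡⟨ cong (λ t → N * #Admissible N t) (oddSize≡[1+h]+[2+h] h) ⟩
  N * ballot h (suc h)     ≡⟨ oddSize*ballot h ⟩
  3 * (N C h)              ≡⟨ cong (λ v → 3 * (N C v)) half ⟨
  3 * (N C ((N ∸ 3) / 2)) ∎
  where
  open ≡-Reasoning
  N = oddSize h
  half : (N ∸ 3) / 2 ≡ h
  half = trans (cong (λ v → (v ∸ 1) / 2) (odd≡ h)) (m*n/n≡m h 2)

theorem3p1 : (n k : ℕ) → 1 ≤ n → k ≤ n →
    ((3 ≤ n × n % 2 ≡ 1 × k ≡ 3) → n * i n k ≡ 3 * (n C ((n ∸ 3) / 2)))
    × (¬ (3 ≤ n × n % 2 ≡ 1 × k ≡ 3) → i n k ≡ 0)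
theorem3p1 n k _ _ = odd-case , i≡0 n k
  where
  odd-case : 3 ≤ n × n % 2 ≡ 1 × k ≡ 3 → n * i n k ≡ 3 * (n C ((n ∸ 3) / 2))
  odd-case (3≤n , n-odd , refl) with odd⇒oddSize n 3≤n n-odd
  ... | h , refl = oddSize*i h
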